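{- Let $A$ be an $\ell\times k$ integer matrix. Suppose that either (i) $S$ is a finite abelian group, or (ii) $S=L^d$ for some finite subset $L$ of a field and some $d\in\mathbb N$. Then for all $W\subseteq Y\subseteq[k]$ and all $w_0\in S^{|W|}$, $$|\mathrm{Sol}^A_S(w_0,W,Y)|\le|S|^{|Y|-|W|-\mathrm{rank}_S(A_{\overline W})+\mathrm{rank}_S(A_{\overline Y})}.$$
   Context: Integers act on abelian groups by repeated addition; in case (ii) $S$ is viewed inside the group $\mathbb F^d$ where $\mathbb F$ is the field containing $L$. For $x\in S^k$, $x_W=(x_i)_{i\in W}$. $\mathrm{Sol}^A_S(w_0,W,Y)$ is the set of $y\in S^{|Y|}$ for which there is $x\in S^k$ with $Ax=0$, $x_Y=y$ and $x_W=w_0$. $A_{\overline W}$ is the submatrix of columns indexed by $[k]\setminus W$. For an integer matrix $M$ with $k'$ columns and $\ell'$ rows: in case (i), $\mathrm{rank}_S(M):=\log_{|S|}|\mathrm{im}(x\mapsto Mx:S^{k'}\to S^{\ell'})|$ if $|S|>1$ and $0$ if $|S|=1$; in case (ii), $\mathrm{rank}_S(M):=0$ if $L=\{0_{\mathbb F}\}$ and otherwise the rank over $\mathbb F$ of the matrix with entries $m_{ij}\cdot1_{\mathbb F}$ (when both cases apply the two definitions agree). The matrix with no columns has rank $0$. -}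

module Defs where

open import Level using (Level; _⊔_) renaming (suc to lsuc)
open import Data.Nat using (ℕ; zero; suc; _≤_)
open import Data.Integer using (ℤ; +_; -[1+_])
open import Data.Bool using (true; false)
open import Data.Product using (Σ; ∃; _×_; _,_)
open import Data.Sum using (_⊎_)
open import Data.List using (List; length)
open import Data.List.Relation.Unary.All as ListAll using ()
open import Data.Vec using (Vec; []; _∷_; map; zipWith; foldr′; replicate)
open import Data.Vec.Relation.Unary.All using (All)
open import Data.Vec.Relation.Binary.Pointwise.Inductive as PW using (Pointwise)
open import Data.Fin.Subset using (Subset; ∣_∣)
open import Algebra.Bundles using (CommutativeRing)
open import Algebra.Bundles.Raw using (RawGroup)
open import Relation.Binary.Bundles using (Setoid)
open import Relation.Binary.PropositionalEquality using (_≡_)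
open import Relation.Nullary using (¬_)
import Data.List.Membership.Setoid as SetoidMembership
import Data.List.Relation.Unary.Unique.Setoid as SetoidUnique

private
  variable
    a c ℓ : Level
    A : Set a
    k m n : ℕ

select : (W : Subset k) → Vec A k → Vec A ∣ W ∣
select []          []       = []
select (true ∷ W)  (x ∷ xs) = x ∷ select W xs
select (false ∷ W) (x ∷ xs) = select W xs

-- A_W : the submatrix of columns indexed by W (matrix = Vec of rows).
cols : ∀ {l} (W : Subset k) → Vec (Vec A k) l → Vec (Vec A ∣ W ∣) l
cols W M = map (select W) M

module ZAction (G : RawGroup c ℓ) where
  open RawGroup G

  _×ₙ_ : ℕ → Carrier → Carrier
  zero  ×ₙ x = ε
  suc n ×ₙ x = x ∙ (n ×ₙ x)

  infixr 8 _·_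
  _·_ : ℤ → Carrier → Carrier
  (+ n)    · x = n ×ₙ x
  -[1+ n ] · x = (suc n ×ₙ x) ⁻¹

  sumV : Vec Carrier n → Carrier
  sumV = foldr′ _∙_ ε

  _*ᴹ_ : ∀ {l} → Vec (Vec ℤ k) l → Vec Carrier k → Vec Carrier l
  M *ᴹ x = map (λ row → sumV (zipWith _·_ row x)) M

  IsZeroVec : Vec Carrier n → Set _
  IsZeroVec {n = n} v = Pointwise _≈_ v (replicate n ε)

  -- Sol^A_S(w0, W, Y), where InS singles out the elements of S inside G.
  Sol : ∀ {l p} (InS : Carrier → Set p) (A : Vec (Vec ℤ k) l)
        (W Y : Subset k) (w0 : Vec Carrier ∣ W ∣) → Vec Carrier ∣ Y ∣ → Set _
  Sol {k = k} InS A W Y w0 y =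
    Σ (Vec Carrier k) λ x →
      All InS x × IsZeroVec (A *ᴹ x) ×
      Pointwise _≈_ (select Y x) y × Pointwise _≈_ (select W x) w0

  Img : ∀ {l} → Vec (Vec ℤ k) l → Vec Carrier l → Set _
  Img {k = k} M z = Σ (Vec Carrier k) λ x → Pointwise _≈_ (M *ᴹ x) z

module Card (T : Setoid c ℓ) where
  open Setoid T
  open SetoidMembership T public using (_∈_)
  open SetoidUnique T public using (Unique)

  HasCard : ∀ {p} → (Carrier → Set p) → ℕ → Set _
  HasCard P n = Σ (List Carrier) λ xs →
    length xs ≡ n × Unique xs × ListAll.All P xs × (∀ x → P x → x ∈ xs)

record Field c ℓ : Set (lsuc (c ⊔ ℓ)) where
  field
    commutativeRing : CommutativeRing c ℓ
  open CommutativeRing commutativeRing public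
  field
    1≉0     : ¬ (1# ≈ 0#)
    inverse : ∀ x → ¬ (x ≈ 0#) → ∃ λ y → x * y ≈ 1#

module FieldRank (F : Field c ℓ) where
  open Field F
  +-rawGroupF : RawGroup c ℓ
  +-rawGroupF = record
    { Carrier = Carrier ; _≈_ = _≈_ ; _∙_ = _+_ ; ε = 0# ; _⁻¹ = -_ }

  open ZAction +-rawGroupF using (_·_)

  toF : ℤ → Carrier
  toF m = m · 1#

  toFMat : ∀ {l} → Vec (Vec ℤ k) l → Vec (Vec Carrier k) l
  toFMat = map (map toF)

  LinIndepCols : ∀ {l} → Vec (Vec Carrier k) l → Subset k → Set _
  LinIndepCols {l = l} M p = (coef : Vec Carrier ∣ p ∣) →
    Pointwise _≈_ (map (λ row → foldr′ _+_ 0# (zipWith _*_ row coef)) (cols p M))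
                  (replicate l 0#) →
    Pointwise _≈_ coef (replicate ∣ p ∣ 0#)

  IsRankF : ∀ {l} → Vec (Vec ℤ k) l → ℕ → Set _
  IsRankF {k = k} M r =
    (Σ (Subset k) λ p → ∣ p ∣ ≡ r × LinIndepCols (toFMat M) p) ×
    (∀ (p : Subset k) → LinIndepCols (toFMat M) p → ∣ p ∣ ≤ r)

  open SetoidMembership setoid using (_∈_)

  IsZeroSet : List Carrier → Set _
  IsZeroSet L = (∀ x → x ∈ L → x ≈ 0#) × 0# ∈ L

  IsRankS : ∀ {l} → List Carrier → Vec (Vec ℤ k) l → ℕ → Set _
  IsRankS L M r = (IsZeroSet L × r ≡ 0) ⊎ (¬ IsZeroSet L × IsRankF M r)

  vecRawGroup : ℕ → RawGroup c (c ⊔ ℓ)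
  vecRawGroup d = record
    { Carrier = Vec Carrier d
    ; _≈_     = Pointwise _≈_
    ; _∙_     = zipWith _+_
    ; ε       = replicate d 0#
    ; _⁻¹     = map (-_)
    }

  vecSetoid : ℕ → Setoid c (c ⊔ ℓ)
  vecSetoid d = record
    { Carrier = Vec Carrier d
    ; _≈_ = Pointwise _≈_
    ; isEquivalence = PW.isEquivalence isEquivalence d
    }

  InL^d : ∀ {d} → List Carrier → Vec Carrier d → Set _
  InL^d L v = All (_∈ L) v

-- Case (i).  Pair a solution y, extended to x ∈ S^k, with an image vector v = A_{∁W} u and
-- put z = u ∙ x, where u is spread over the coordinates ∁W.  Then z_W = w0 and A z = v, so
-- (y, v) can be recovered from z_{Y─W} ∈ S^{|Y|-|W|} and A_{∁Y} z_{∁Y} ∈ im A_{∁Y}.  This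
-- injection gives |Sol| |im A_{∁W}| ≤ |S|^{|Y|-|W|} |im A_{∁Y}|.
--
-- Case (ii).  Over the field, choose a maximum independent set SY of columns of ∁Y and
-- extend it greedily by columns of Y─W to an independent set T spanning all columns of ∁W.
-- By the exchange lemma T has at least rank A_{∁W} elements, so Q = (Y─W) ─ T has at most
-- |Y|-|W|-rank A_{∁W}+rank A_{∁Y} elements, and a kernel vector of A vanishing on W ∪ Q
-- vanishes on Y.  Applied coordinatewise to the difference of two solutions, this shows a
-- solution is determined on Y by its values on Q, which lie in (L^d)^|Q|.  Equality in the
-- field need not be decidable, so the linear algebra is done under double negation; this is
-- harmless because the final conclusions are decidable statements about natural numbers.

module Submission where

open import Defs
open import Level using (Level; _⊔_)
open import Algebra.Bundles using (AbelianGroup)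
open import Data.Bool using (true; false)
open import Data.Fin using (Fin; zero; suc; punchIn; punchOut; _≟_; combine; remQuot; funToFin; finToFun)
open import Data.Fin.Properties
  using (punchIn-punchOut; punchInᵢ≢i; injective⇒≤; combine-injective; combine-remQuot; finToFun-funToFin)
open import Data.Fin.Subset using (Subset; ∣_∣; _∈_; _∉_; _⊆_; ∁; _─_; _∪_; ⁅_⁆)
open import Data.Fin.Subset.Properties
  using ( _∈?_; ⊆-refl; drop-∷-⊆; s⊆s; out⊆; p⊆q⇒∣p∣≤∣q∣; ∣p∣≤∣x∷p∣; ∪-identityʳ; x∈p⇒x∉∁p; x∉p⇒x∈∁p
        ; x∈∁p⇒x∉p; x∈p∧x∉q⇒x∈p─q; p─q⊆p; p⊆q⇒∁p⊇∁q; x∈p∪q⁻; x∈p∪q⁺; x∈⁅y⁆⇒x≡y; x∈⁅x⁆ )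
open import Data.Integer using (ℤ)
open import Data.List as List using (List; []; _∷_; length; filter; allFin)
open import Data.List.Membership.Propositional using () renaming (_∈_ to _∈ˡ_)
open import Data.List.Membership.Propositional.Properties using (∈-lookup; ∈-filter⁺; ∈-filter⁻; ∈-allFin)
import Data.List.Membership.Setoid as SetoidMembership
open import Data.List.Relation.Unary.All as LAll using ([]; _∷_)
open import Data.List.Relation.Unary.AllPairs using ([]; _∷_)
open import Data.List.Relation.Unary.Any using (here; there; index)
open import Data.List.Relation.Unary.Any.Properties using (lookup-result)
import Data.List.Relation.Unary.Unique.Setoid as SetoidUnique
open import Data.Nat as ℕ using (ℕ; zero; suc; _∸_; _^_; _≤_; _≤?_; z≤n; s≤s)
import Data.Nat.Properties as ℕ
open import Data.Product using (Σ; ∃; _×_; _,_; proj₁; proj₂)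
open import Data.Sum as Sum using (_⊎_; inj₁; inj₂; [_,_])
open import Data.Unit.Polymorphic using (⊤; tt)
open import Data.Vec as Vec using (Vec; []; _∷_; lookup; tabulate; zipWith; map; replicate; foldr′)
open import Data.Vec.Properties using (lookup-map; lookup-zipWith; lookup-replicate; lookup∘tabulate)
open import Data.Vec.Functional using (Vector; insertAt)
open import Data.Vec.Functional.Properties using (insertAt-lookup; insertAt-punchIn)
open import Data.Vec.Relation.Binary.Pointwise.Inductive as PW using (Pointwise; []; _∷_)
import Data.Vec.Relation.Binary.Pointwise.Extensional as PWₑ
open import Data.Vec.Relation.Unary.All as VAll using ([]; _∷_)
open import Data.Vec.Relation.Unary.All.Properties using (lookup⁺)
open import Function using (_∘_)
open import Relation.Binary.Bundles using (Setoid)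
open import Relation.Binary.PropositionalEquality as ≡ using (_≡_; _≢_; cong)
open import Relation.Nullary using (¬_; Dec; yes; no)
open import Relation.Nullary.Decidable using (decidable-stable; ¬¬-excluded-middle; toSum)
open import Relation.Nullary.Negation using (contradiction; ¬¬-map)

private
  variable
    a b c ℓ ℓ′ r : Level
    A B : Set a
    k l m n : ℕ

-- Double negation

-- a level-polymorphic bind (unlike ¬¬-Monad), so that do-blocks can mix propositions of any level
infixl 1 _>>=_
_>>=_ : ¬ ¬ A → (A → ¬ ¬ B) → ¬ ¬ B
(¬¬a >>= f) ¬b = ¬¬a λ a → f a ¬b

return : A → ¬ ¬ A
return a ¬a = ¬a a

¬¬-decide-∀ : (P : Fin n → Set ℓ′) → ¬ ¬ ((∀ i → P i) ⊎ ∃ λ i → ¬ P i)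
¬¬-decide-∀ {n = zero}  P = return (inj₁ λ ())
¬¬-decide-∀ {n = suc n} P = do
  P0? ← ¬¬-excluded-middle
  rest ← ¬¬-decide-∀ (P ∘ suc)
  return (merge P0? rest)
  where
    merge : Dec (P zero) → (∀ i → P (suc i)) ⊎ ∃ (λ i → ¬ P (suc i)) →
            (∀ i → P i) ⊎ ∃ λ i → ¬ P i
    merge (no ¬P0) _                = inj₂ (zero , ¬P0)
    merge (yes P0) (inj₁ P+)        = inj₁ λ { zero → P0 ; (suc i) → P+ i }
    merge (yes P0) (inj₂ (i , ¬Pi)) = inj₂ (suc i , ¬Pi)

¬¬-∀ : {P : Fin n → Set ℓ′} → (∀ i → ¬ ¬ P i) → ¬ ¬ (∀ i → P i)
¬¬-∀ {P = P} ¬¬P = do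
  inj₁ ∀P ← ¬¬-decide-∀ P
    where inj₂ (i , ¬Pi) → λ _ → ¬¬P i ¬Pi
  return ∀P

enum : (S : Subset k) → Fin ∣ S ∣ → Fin k
enum (true  ∷ S) zero    = zero
enum (true  ∷ S) (suc i) = suc (enum S i)
enum (false ∷ S) i       = suc (enum S i)

enum-∈ : (S : Subset k) (i : Fin ∣ S ∣) → enum S i ∈ S
enum-∈ (true  ∷ S) zero    = Vec.here
enum-∈ (true  ∷ S) (suc i) = Vec.there (enum-∈ S i)
enum-∈ (false ∷ S) i       = Vec.there (enum-∈ S i)

∈⇒≡enum : ∀ {S : Subset k} {t} → t ∈ S → ∃ λ i → enum S i ≡ t
∈⇒≡enum {S = true  ∷ S} Vec.here          = zero , ≡.refl
∈⇒≡enum {S = true  ∷ S} (Vec.there t∈S)   with i , ≡.refl ← ∈⇒≡enum t∈S = suc i , ≡.refl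
∈⇒≡enum {S = false ∷ S} (Vec.there t∈S)   with i , ≡.refl ← ∈⇒≡enum t∈S = i , ≡.refl

scatter : A → (S : Subset k) → Vec A ∣ S ∣ → Vec A k
scatter d []          []       = []
scatter d (true  ∷ S) (u ∷ us) = u ∷ scatter d S us
scatter d (false ∷ S) us       = d ∷ scatter d S us

lookup-select : (S : Subset k) (xs : Vec A k) (i : Fin ∣ S ∣) →
                lookup (select S xs) i ≡ lookup xs (enum S i)
lookup-select (true  ∷ S) (x ∷ xs) zero    = ≡.refl
lookup-select (true  ∷ S) (x ∷ xs) (suc i) = lookup-select S xs i
lookup-select (false ∷ S) (x ∷ xs) i       = lookup-select S xs i

lookup-scatter-enum : (d : A) (S : Subset k) (u : Vec A ∣ S ∣) (i : Fin ∣ S ∣) →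
                      lookup (scatter d S u) (enum S i) ≡ lookup u i
lookup-scatter-enum d (true  ∷ S) (u ∷ us) zero    = ≡.refl
lookup-scatter-enum d (true  ∷ S) (u ∷ us) (suc i) = lookup-scatter-enum d S us i
lookup-scatter-enum d (false ∷ S) us       i       = lookup-scatter-enum d S us i

lookup-scatter-∉ : (d : A) (S : Subset k) (u : Vec A ∣ S ∣) {t : Fin k} →
                   t ∉ S → lookup (scatter d S u) t ≡ d
lookup-scatter-∉ d (true  ∷ S) (u ∷ us) {zero}  t∉S = contradiction Vec.here t∉S
lookup-scatter-∉ d (true  ∷ S) (u ∷ us) {suc t} t∉S = lookup-scatter-∉ d S us (t∉S ∘ Vec.there)
lookup-scatter-∉ d (false ∷ S) us       {zero}  t∉S = ≡.refl
lookup-scatter-∉ d (false ∷ S) us       {suc t} t∉S = lookup-scatter-∉ d S us (t∉S ∘ Vec.there)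

module _ {R : A → B → Set r} where

  select-pointwise⁺ : (S : Subset k) {xs : Vec A k} {ys : Vec B k} →
                      (∀ {t} → t ∈ S → R (lookup xs t) (lookup ys t)) →
                      Pointwise R (select S xs) (select S ys)
  select-pointwise⁺ []          {[]}     {[]}     h = []
  select-pointwise⁺ (true  ∷ S) {x ∷ xs} {y ∷ ys} h = h Vec.here ∷ select-pointwise⁺ S (h ∘ Vec.there)
  select-pointwise⁺ (false ∷ S) {x ∷ xs} {y ∷ ys} h = select-pointwise⁺ S (h ∘ Vec.there)

  select-pointwise⁻ : (S : Subset k) {xs : Vec A k} {ys : Vec B k} →
                      Pointwise R (select S xs) (select S ys) →
                      ∀ {t} → t ∈ S → R (lookup xs t) (lookup ys t)
  select-pointwise⁻ (true  ∷ S) {x ∷ xs} {y ∷ ys} (r ∷ rs) Vec.here        = r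
  select-pointwise⁻ (true  ∷ S) {x ∷ xs} {y ∷ ys} (r ∷ rs) (Vec.there t∈S) = select-pointwise⁻ S rs t∈S
  select-pointwise⁻ (false ∷ S) {x ∷ xs} {y ∷ ys} rs       (Vec.there t∈S) = select-pointwise⁻ S rs t∈S

All-select : {P : A → Set ℓ′} (S : Subset k) {xs : Vec A k} → VAll.All P xs → VAll.All P (select S xs)
All-select []          []       = []
All-select (true  ∷ S) (p ∷ ps) = p ∷ All-select S ps
All-select (false ∷ S) (p ∷ ps) = All-select S ps

module _ where
  open import Data.Nat using (_+_)

  ∣Y∣≡∣W∣+∣Y─W∣ : {W Y : Subset k} → W ⊆ Y → ∣ Y ∣ ≡ ∣ W ∣ + ∣ Y ─ W ∣
  ∣Y∣≡∣W∣+∣Y─W∣ {W = []}        {[]}        W⊆Y = ≡.refl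
  ∣Y∣≡∣W∣+∣Y─W∣ {W = true  ∷ W} {true  ∷ Y} W⊆Y = cong suc (∣Y∣≡∣W∣+∣Y─W∣ (drop-∷-⊆ W⊆Y))
  ∣Y∣≡∣W∣+∣Y─W∣ {W = true  ∷ W} {false ∷ Y} W⊆Y with () ← W⊆Y Vec.here
  ∣Y∣≡∣W∣+∣Y─W∣ {W = false ∷ W} {true  ∷ Y} W⊆Y =
    ≡.trans (cong suc (∣Y∣≡∣W∣+∣Y─W∣ (drop-∷-⊆ W⊆Y))) (≡.sym (ℕ.+-suc _ _))
  ∣Y∣≡∣W∣+∣Y─W∣ {W = false ∷ W} {false ∷ Y} W⊆Y = ∣Y∣≡∣W∣+∣Y─W∣ (drop-∷-⊆ W⊆Y)

  ∣Y∣∸∣W∣≡∣Y─W∣ : {W Y : Subset k} → W ⊆ Y → ∣ Y ∣ ∸ ∣ W ∣ ≡ ∣ Y ─ W ∣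
  ∣Y∣∸∣W∣≡∣Y─W∣ {W = W} {Y} W⊆Y = ≡.trans (cong (_∸ ∣ W ∣) (∣Y∣≡∣W∣+∣Y─W∣ W⊆Y)) (ℕ.m+n∸m≡n ∣ W ∣ ∣ Y ─ W ∣)

  ∣p∪⁅i⁆∣≡1+∣p∣ : (p : Subset k) {i : Fin k} → i ∉ p → ∣ p ∪ ⁅ i ⁆ ∣ ≡ suc ∣ p ∣
  ∣p∪⁅i⁆∣≡1+∣p∣ (true  ∷ p) {zero}  i∉p = contradiction Vec.here i∉p
  ∣p∪⁅i⁆∣≡1+∣p∣ (false ∷ p) {zero}  i∉p = cong suc (cong ∣_∣ (∪-identityʳ p))
  ∣p∪⁅i⁆∣≡1+∣p∣ (true  ∷ p) {suc i} i∉p = cong suc (∣p∪⁅i⁆∣≡1+∣p∣ p (i∉p ∘ Vec.there))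
  ∣p∪⁅i⁆∣≡1+∣p∣ (false ∷ p) {suc i} i∉p = ∣p∪⁅i⁆∣≡1+∣p∣ p (i∉p ∘ Vec.there)

  ∣p∣+∣q─p∣≤∣r∣+∣q∣ : {p q r : Subset k} → p ⊆ r ∪ q → ∣ p ∣ + ∣ q ─ p ∣ ≤ ∣ r ∣ + ∣ q ∣
  ∣p∣+∣q─p∣≤∣r∣+∣q∣ {p = []} {[]} {[]} p⊆r∪q = z≤n
  ∣p∣+∣q─p∣≤∣r∣+∣q∣ {p = true ∷ p} {q₀ ∷ q} {true ∷ r} p⊆r∪q =
    s≤s (ℕ.≤-trans (∣p∣+∣q─p∣≤∣r∣+∣q∣ (drop-∷-⊆ p⊆r∪q)) (ℕ.+-monoʳ-≤ ∣ r ∣ (∣p∣≤∣x∷p∣ q₀ q)))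
  ∣p∣+∣q─p∣≤∣r∣+∣q∣ {p = true ∷ p} {true ∷ q} {false ∷ r} p⊆r∪q =
    ≡.subst (suc (∣ p ∣ + ∣ q ─ p ∣) ≤_) (≡.sym (ℕ.+-suc ∣ r ∣ ∣ q ∣)) (s≤s (∣p∣+∣q─p∣≤∣r∣+∣q∣ (drop-∷-⊆ p⊆r∪q)))
  ∣p∣+∣q─p∣≤∣r∣+∣q∣ {p = true ∷ p} {false ∷ q} {false ∷ r} p⊆r∪q with () ← p⊆r∪q Vec.here
  ∣p∣+∣q─p∣≤∣r∣+∣q∣ {p = false ∷ p} {true ∷ q} {r₀ ∷ r} p⊆r∪q =
    ≡.subst₂ _≤_ (≡.sym (ℕ.+-suc ∣ p ∣ ∣ q ─ p ∣)) (≡.sym (ℕ.+-suc ∣ r₀ ∷ r ∣ ∣ q ∣))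
      (s≤s (ℕ.≤-trans (∣p∣+∣q─p∣≤∣r∣+∣q∣ (drop-∷-⊆ p⊆r∪q)) (ℕ.+-monoˡ-≤ ∣ q ∣ (∣p∣≤∣x∷p∣ r₀ r))))
  ∣p∣+∣q─p∣≤∣r∣+∣q∣ {p = false ∷ p} {false ∷ q} {r₀ ∷ r} p⊆r∪q =
    ℕ.≤-trans (∣p∣+∣q─p∣≤∣r∣+∣q∣ (drop-∷-⊆ p⊆r∪q)) (ℕ.+-monoˡ-≤ ∣ q ∣ (∣p∣≤∣x∷p∣ r₀ r))

  ⊆-interpolate : {p q : Subset k} → p ⊆ q → ∀ m → ∣ p ∣ ≤ m → m ≤ ∣ q ∣ →
                  ∃ λ r → p ⊆ r × r ⊆ q × ∣ r ∣ ≡ m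
  ⊆-interpolate {p = []} {[]} p⊆q .0 z≤n z≤n = [] , (λ ()) , (λ ()) , ≡.refl
  ⊆-interpolate {p = true ∷ p} {false ∷ q} p⊆q m _ _ with () ← p⊆q Vec.here
  ⊆-interpolate {p = true ∷ p} {true ∷ q} p⊆q (suc m) (s≤s p≤m) (s≤s m≤q)
    with r , p⊆r , r⊆q , ∣r∣≡m ← ⊆-interpolate (drop-∷-⊆ p⊆q) m p≤m m≤q
    = true ∷ r , s⊆s p⊆r , s⊆s r⊆q , cong suc ∣r∣≡m
  ⊆-interpolate {p = false ∷ p} {false ∷ q} p⊆q m p≤m m≤q
    with r , p⊆r , r⊆q , ∣r∣≡m ← ⊆-interpolate (drop-∷-⊆ p⊆q) m p≤m m≤q
    = false ∷ r , s⊆s p⊆r , s⊆s r⊆q , ∣r∣≡m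
  ⊆-interpolate {p = false ∷ p} {true ∷ q} p⊆q m p≤m m≤1+q with m ℕ.≤? ∣ q ∣
  ... | yes m≤q with r , p⊆r , r⊆q , ∣r∣≡m ← ⊆-interpolate (drop-∷-⊆ p⊆q) m p≤m m≤q
    = false ∷ r , s⊆s p⊆r , out⊆ r⊆q , ∣r∣≡m
  ... | no m≰q with ≡.refl ← ℕ.≤-antisym m≤1+q (ℕ.≰⇒> m≰q)
    with r , p⊆r , r⊆q , ∣r∣≡m ← ⊆-interpolate (drop-∷-⊆ p⊆q) ∣ q ∣ (p⊆q⇒∣p∣≤∣q∣ (drop-∷-⊆ p⊆q)) ℕ.≤-refl
    = true ∷ r , out⊆ p⊆r , s⊆s r⊆q , cong suc ∣r∣≡m

  ∸+-rearrange : ∀ {w m s r y} → y ≡ w + m → r ≤ m + s → m + s ∸ r + w + r ≡ y + s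
  ∸+-rearrange {w} {m} {s} {r} {y} y≡w+m r≤m+s = begin
    m + s ∸ r + w + r     ≡⟨ ℕ.+-assoc (m + s ∸ r) w r ⟩
    m + s ∸ r + (w + r)   ≡⟨ cong (m + s ∸ r +_) (ℕ.+-comm w r) ⟩
    m + s ∸ r + (r + w)   ≡⟨ ℕ.+-assoc (m + s ∸ r) r w ⟨
    m + s ∸ r + r + w     ≡⟨ cong (_+ w) (ℕ.m∸n+n≡m r≤m+s) ⟩
    m + s + w             ≡⟨ ℕ.+-comm (m + s) w ⟩
    w + (m + s)           ≡⟨ ℕ.+-assoc w m s ⟨
    w + m + s             ≡⟨ cong (_+ s) y≡w+m ⟨
    y + s                 ∎
    where open ≡.≡-Reasoning

-- the elements of Q at the positions (in the order of Q) selected by p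
embed : (Q : Subset k) → Subset ∣ Q ∣ → Subset k
embed = scatter false

∈-embed⁻ : (Q : Subset k) (p : Subset ∣ Q ∣) {t : Fin k} → t ∈ embed Q p → ∃ λ i → enum Q (enum p i) ≡ t
∈-embed⁻ (true  ∷ Q) (true  ∷ p) Vec.here             = zero , ≡.refl
∈-embed⁻ (true  ∷ Q) (true  ∷ p) (Vec.there t∈Qp)     with i , ≡.refl ← ∈-embed⁻ Q p t∈Qp = suc i , ≡.refl
∈-embed⁻ (true  ∷ Q) (false ∷ p) (Vec.there t∈Qp)     with i , ≡.refl ← ∈-embed⁻ Q p t∈Qp = i , ≡.refl
∈-embed⁻ (false ∷ Q) p           (Vec.there t∈Qp)     with i , ≡.refl ← ∈-embed⁻ Q p t∈Qp = i , ≡.refl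

lookup-scatter²-∉ : (d : A) (Q : Subset k) (p : Subset ∣ Q ∣) (u : Vec A ∣ p ∣) {t : Fin k} →
                    t ∉ embed Q p → lookup (scatter d Q (scatter d p u)) t ≡ d
lookup-scatter²-∉ d (true  ∷ Q) (true  ∷ p) (u ∷ us) {zero}  t∉Qp = contradiction Vec.here t∉Qp
lookup-scatter²-∉ d (true  ∷ Q) (false ∷ p) us       {zero}  t∉Qp = ≡.refl
lookup-scatter²-∉ d (false ∷ Q) p           us       {zero}  t∉Qp = ≡.refl
lookup-scatter²-∉ d (true  ∷ Q) (true  ∷ p) (u ∷ us) {suc t} t∉Qp = lookup-scatter²-∉ d Q p us (t∉Qp ∘ Vec.there)
lookup-scatter²-∉ d (true  ∷ Q) (false ∷ p) us       {suc t} t∉Qp = lookup-scatter²-∉ d Q p us (t∉Qp ∘ Vec.there)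
lookup-scatter²-∉ d (false ∷ Q) p           us       {suc t} t∉Qp = lookup-scatter²-∉ d Q p us (t∉Qp ∘ Vec.there)

embed-select : {Q S : Subset k} → S ⊆ Q → embed Q (select Q S) ≡ S
embed-select {Q = []}        {[]}        S⊆Q = ≡.refl
embed-select {Q = true  ∷ Q} {s ∷ S}     S⊆Q = cong (s ∷_) (embed-select (drop-∷-⊆ S⊆Q))
embed-select {Q = false ∷ Q} {true  ∷ S} S⊆Q with () ← S⊆Q Vec.here
embed-select {Q = false ∷ Q} {false ∷ S} S⊆Q = cong (false ∷_) (embed-select (drop-∷-⊆ S⊆Q))

∣embed∣ : (Q : Subset k) (p : Subset ∣ Q ∣) → ∣ embed Q p ∣ ≡ ∣ p ∣
∣embed∣ []          []          = ≡.refl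
∣embed∣ (true  ∷ Q) (true  ∷ p) = cong suc (∣embed∣ Q p)
∣embed∣ (true  ∷ Q) (false ∷ p) = ∣embed∣ Q p
∣embed∣ (false ∷ Q) p           = ∣embed∣ Q p

record Coding (T : Setoid c ℓ) (P : Setoid.Carrier T → Set ℓ′) (n : ℕ) : Set (c ⊔ ℓ ⊔ ℓ′) where
  open Setoid T
  field
    code           : ∀ {x} → P x → Fin n
    code-injective : ∀ {x y} (px : P x) (py : P y) → code px ≡ code py → x ≈ y

module _ (T : Setoid c ℓ) where
  open Setoid T using (Carrier; _≈_; reflexive; sym; trans)
  open SetoidMembership T using () renaming (_∈_ to _∈ₛ_)
  open SetoidUnique T using (Unique)

  listCoding : (xs : List Carrier) → Coding T (_∈ₛ xs) (length xs)
  listCoding xs = record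
    { code           = index
    ; code-injective = λ px py eq →
        trans (lookup-result px) (trans (reflexive (cong (List.lookup xs) eq)) (sym (lookup-result py)))
    }

  vecCoding : {P : Carrier → Set ℓ′} → Coding T P n → Coding (PW.setoid T m) (VAll.All P) (n ^ m)
  vecCoding {m = m} C = record
    { code           = λ ps → funToFin (λ i → code (lookup⁺ ps i))
    ; code-injective = λ ps qs eq → PWₑ.extensional⇒inductive (PWₑ.ext λ i →
        code-injective (lookup⁺ ps i) (lookup⁺ qs i)
          (≡.trans (≡.sym (finToFun-funToFin _ i))
            (≡.trans (cong (λ z → finToFun z i) eq) (finToFun-funToFin _ i))))
    }
    where open Coding C

  Unique⇒lookup-injective : ∀ {xs} → Unique xs → ∀ {i j} →
                            List.lookup xs i ≈ List.lookup xs j → i ≡ j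
  Unique⇒lookup-injective (x∉xs ∷ u) {zero}  {zero}  eq = ≡.refl
  Unique⇒lookup-injective (x∉xs ∷ u) {zero}  {suc j} eq = contradiction eq (LAll.lookup x∉xs (∈-lookup j))
  Unique⇒lookup-injective (x∉xs ∷ u) {suc i} {zero}  eq = contradiction (sym eq) (LAll.lookup x∉xs (∈-lookup i))
  Unique⇒lookup-injective (x∉xs ∷ u) {suc i} {suc j} eq = cong suc (Unique⇒lookup-injective u eq)

  length≤ : ∀ {xs N} → Unique xs → (f : Fin (length xs) → Fin N) →
            (∀ {i j} → f i ≡ f j → List.lookup xs i ≈ List.lookup xs j) → length xs ≤ N
  length≤ u f f-inj = injective⇒≤ (Unique⇒lookup-injective u ∘ f-inj)

module _ (S : Setoid a ℓ) (T : Setoid c r) where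
  open import Data.Nat using (_*_)
  private
    module S = Setoid S
    module T = Setoid T

  length*length≤ : ∀ {xs zs N} → SetoidUnique.Unique S xs → SetoidUnique.Unique T zs →
    (f : Fin (length xs) → Fin (length zs) → Fin N) →
    (∀ {i j i′ j′} → f i j ≡ f i′ j′ →
       List.lookup xs i S.≈ List.lookup xs i′ × List.lookup zs j T.≈ List.lookup zs j′) →
    length xs * length zs ≤ N
  length*length≤ {xs} {zs} {N} uxs uzs f f-inj = injective⇒≤ g-injective
    where
      split : Fin (length xs * length zs) → Fin (length xs) × Fin (length zs)
      split = remQuot {length xs} (length zs)

      g : Fin (length xs * length zs) → Fin N
      g t = f (proj₁ (split t)) (proj₂ (split t))
      g-injective : ∀ {s t} → g s ≡ g t → s ≡ t
      g-injective {s} {t} eq = begin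
        s                                         ≡⟨ combine-remQuot {length xs} (length zs) s ⟨
        combine (proj₁ (split s)) (proj₂ (split s)) ≡⟨ ≡.cong₂ combine (Unique⇒lookup-injective S uxs (proj₁ (f-inj eq)))
                                                                    (Unique⇒lookup-injective T uzs (proj₂ (f-inj eq))) ⟩
        combine (proj₁ (split t)) (proj₂ (split t)) ≡⟨ combine-remQuot {length xs} (length zs) t ⟩
        t                                         ∎
        where open ≡.≡-Reasoning

-- Integer matrices over an abelian group

module IntegerMatrixAction (G : AbelianGroup c ℓ) where
  open AbelianGroup G
  open ZAction rawGroup public
  open import Algebra.Properties.AbelianGroup G using (⁻¹-∙-comm; ε⁻¹≈ε)
  open import Algebra.Properties.CommutativeSemigroup commutativeSemigroup using (interchange)
  open import Data.Vec.Relation.Binary.Equality.Setoid setoid public using (_≋_; ≋-refl; ≋-sym; ≋-trans)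
  open import Relation.Binary.Reasoning.Setoid setoid
  open import Data.Integer using (+_; -[1+_])

  ×ₙ-cong : ∀ n {x y} → x ≈ y → n ×ₙ x ≈ n ×ₙ y
  ×ₙ-cong zero    x≈y = refl
  ×ₙ-cong (suc n) x≈y = ∙-cong x≈y (×ₙ-cong n x≈y)

  ×ₙ-ε : ∀ n → n ×ₙ ε ≈ ε
  ×ₙ-ε zero    = refl
  ×ₙ-ε (suc n) = trans (identityˡ _) (×ₙ-ε n)

  ×ₙ-distrib-∙ : ∀ n x y → n ×ₙ (x ∙ y) ≈ n ×ₙ x ∙ n ×ₙ y
  ×ₙ-distrib-∙ zero    x y = sym (identityˡ ε)
  ×ₙ-distrib-∙ (suc n) x y = trans (∙-congˡ (×ₙ-distrib-∙ n x y)) (interchange _ _ _ _)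

  ·-cong : ∀ z {x y} → x ≈ y → z · x ≈ z · y
  ·-cong (+ n)    x≈y = ×ₙ-cong n x≈y
  ·-cong -[1+ n ] x≈y = ⁻¹-cong (×ₙ-cong (suc n) x≈y)

  ·-ε : ∀ z → z · ε ≈ ε
  ·-ε (+ n)    = ×ₙ-ε n
  ·-ε -[1+ n ] = trans (⁻¹-cong (×ₙ-ε (suc n))) ε⁻¹≈ε

  ·-distrib-∙ : ∀ z x y → z · (x ∙ y) ≈ z · x ∙ z · y
  ·-distrib-∙ (+ n)    x y = ×ₙ-distrib-∙ n x y
  ·-distrib-∙ -[1+ n ] x y = trans (⁻¹-cong (×ₙ-distrib-∙ (suc n) x y)) (sym (⁻¹-∙-comm _ _))

  infix 8 _⟨·⟩_
  _⟨·⟩_ : Vec ℤ k → Vec Carrier k → Carrier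
  row ⟨·⟩ x = sumV (zipWith _·_ row x)

  ⟨·⟩-cong : (row : Vec ℤ k) {x y : Vec Carrier k} → x ≋ y → row ⟨·⟩ x ≈ row ⟨·⟩ y
  ⟨·⟩-cong []          []          = refl
  ⟨·⟩-cong (z ∷ row) (x≈y ∷ xs≈ys) = ∙-cong (·-cong z x≈y) (⟨·⟩-cong row xs≈ys)

  ⟨·⟩-distrib-∙ : (row : Vec ℤ k) (x y : Vec Carrier k) →
                  row ⟨·⟩ zipWith _∙_ x y ≈ row ⟨·⟩ x ∙ row ⟨·⟩ y
  ⟨·⟩-distrib-∙ []        []       []       = sym (identityˡ ε)
  ⟨·⟩-distrib-∙ (z ∷ row) (x ∷ xs) (y ∷ ys) =
    trans (∙-cong (·-distrib-∙ z x y) (⟨·⟩-distrib-∙ row xs ys)) (interchange _ _ _ _)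

  ⟨·⟩-split : (S : Subset k) (row : Vec ℤ k) (x : Vec Carrier k) →
              row ⟨·⟩ x ≈ select S row ⟨·⟩ select S x ∙ select (∁ S) row ⟨·⟩ select (∁ S) x
  ⟨·⟩-split []          []        []       = sym (identityˡ ε)
  ⟨·⟩-split (true  ∷ S) (z ∷ row) (x ∷ xs) = trans (∙-congˡ (⟨·⟩-split S row xs)) (sym (assoc _ _ _))
  ⟨·⟩-split (false ∷ S) (z ∷ row) (x ∷ xs) = begin
    z · x ∙ row ⟨·⟩ xs        ≈⟨ ∙-congˡ (⟨·⟩-split S row xs) ⟩
    z · x ∙ (σ ∙ τ)           ≈⟨ ∙-congˡ (comm σ τ) ⟩
    z · x ∙ (τ ∙ σ)           ≈⟨ assoc _ _ _ ⟨
    (z · x ∙ τ) ∙ σ           ≈⟨ comm _ σ ⟩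
    σ ∙ (z · x ∙ τ)           ∎
    where
      σ τ : Carrier
      σ = select S row ⟨·⟩ select S xs
      τ = select (∁ S) row ⟨·⟩ select (∁ S) xs

  ⟨·⟩-scatter : (S : Subset k) (row : Vec ℤ k) (u : Vec Carrier ∣ S ∣) →
                row ⟨·⟩ scatter ε S u ≈ select S row ⟨·⟩ u
  ⟨·⟩-scatter []          []        []       = refl
  ⟨·⟩-scatter (true  ∷ S) (z ∷ row) (u ∷ us) = ∙-congˡ (⟨·⟩-scatter S row us)
  ⟨·⟩-scatter (false ∷ S) (z ∷ row) us       =
    trans (∙-cong (·-ε z) (⟨·⟩-scatter S row us)) (identityˡ _)

  *ᴹ-cong : (A : Vec (Vec ℤ k) l) {x y : Vec Carrier k} → x ≋ y → A *ᴹ x ≋ A *ᴹ y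
  *ᴹ-cong []        x≈y = []
  *ᴹ-cong (row ∷ A) x≈y = ⟨·⟩-cong row x≈y ∷ *ᴹ-cong A x≈y

  *ᴹ-distrib-∙ : (A : Vec (Vec ℤ k) l) (x y : Vec Carrier k) →
                 A *ᴹ zipWith _∙_ x y ≋ zipWith _∙_ (A *ᴹ x) (A *ᴹ y)
  *ᴹ-distrib-∙ []        x y = []
  *ᴹ-distrib-∙ (row ∷ A) x y = ⟨·⟩-distrib-∙ row x y ∷ *ᴹ-distrib-∙ A x y

  *ᴹ-split : (S : Subset k) (A : Vec (Vec ℤ k) l) (x : Vec Carrier k) →
             A *ᴹ x ≋ zipWith _∙_ (cols S A *ᴹ select S x) (cols (∁ S) A *ᴹ select (∁ S) x)
  *ᴹ-split S []        x = []
  *ᴹ-split S (row ∷ A) x = ⟨·⟩-split S row x ∷ *ᴹ-split S A x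

  *ᴹ-scatter : (S : Subset k) (A : Vec (Vec ℤ k) l) (u : Vec Carrier ∣ S ∣) →
               A *ᴹ scatter ε S u ≋ cols S A *ᴹ u
  *ᴹ-scatter S []        u = []
  *ᴹ-scatter S (row ∷ A) u = ⟨·⟩-scatter S row u ∷ *ᴹ-scatter S A u

-- Case (i): finite abelian groups

module FiniteAbelianGroup (G : AbelianGroup c ℓ) where
  open AbelianGroup G
  open IntegerMatrixAction G
  open import Algebra.Properties.AbelianGroup G using (∙-cancelˡ)
  open import Data.Nat using (_*_)
  open SetoidMembership setoid using () renaming (_∈_ to _∈ₛ_)
  open SetoidUnique using (Unique)

  _∈ᵛ_ : Vec Carrier l → List (Vec Carrier l) → Set (c ⊔ ℓ)
  _∈ᵛ_ {l} = SetoidMembership._∈_ (PW.setoid setoid l)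

  solutions*image≤ : ∀ {InS : Carrier → Set ℓ′} (gs : List Carrier) → (∀ g → g ∈ₛ gs) →
    (A : Vec (Vec ℤ k) l) {W Y : Subset k} → W ⊆ Y → (w0 : Vec Carrier ∣ W ∣) →
    {vs : List (Vec Carrier l)} → Unique (PW.setoid setoid l) vs → LAll.All (Img (cols (∁ W) A)) vs →
    {cs : List (Vec Carrier l)} → (∀ v → Img (cols (∁ Y) A) v → v ∈ᵛ cs) →
    {ys : List (Vec Carrier ∣ Y ∣)} → Unique (PW.setoid setoid ∣ Y ∣) ys → LAll.All (Sol InS A W Y w0) ys →
    length ys * length vs ≤ length gs ^ ∣ Y ─ W ∣ * length cs
  solutions*image≤ {k = k} {l} {InS = InS} gs gs-complete A {W} {Y} W⊆Y w0
                   {vs} vs-unique vs-images {cs} cs-complete {ys} ys-unique sols =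
    length*length≤ (PW.setoid setoid ∣ Y ∣) (PW.setoid setoid l) ys-unique vs-unique f f-injective
    where
      sol : ∀ i → Sol InS A W Y w0 (List.lookup ys i)
      sol i = LAll.lookup sols (∈-lookup i)

      x : Fin (length ys) → Vec Carrier k
      x i = proj₁ (sol i)

      A*x≈ε : ∀ i → IsZeroVec (A *ᴹ x i)
      A*x≈ε i = proj₁ (proj₂ (proj₂ (sol i)))

      xY≈y : ∀ i → select Y (x i) ≋ List.lookup ys i
      xY≈y i = proj₁ (proj₂ (proj₂ (proj₂ (sol i))))

      xW≈w0 : ∀ i → select W (x i) ≋ w0
      xW≈w0 i = proj₂ (proj₂ (proj₂ (proj₂ (sol i))))

      u : Fin (length vs) → Vec Carrier ∣ ∁ W ∣
      u j = proj₁ (LAll.lookup vs-images (∈-lookup j))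

      U : Fin (length vs) → Vec Carrier k
      U j = scatter ε (∁ W) (u j)

      z : Fin (length ys) → Fin (length vs) → Vec Carrier k
      z i j = zipWith _∙_ (U j) (x i)

      image : Fin (length ys) → Fin (length vs) → Vec Carrier l
      image i j = cols (∁ Y) A *ᴹ select (∁ Y) (z i j)

      image∈cs : ∀ i j → image i j ∈ᵛ cs
      image∈cs i j = cs-complete _ (_ , ≋-refl)

      codeᴰ : Coding (PW.setoid setoid ∣ Y ─ W ∣) (VAll.All (_∈ₛ gs)) (length gs ^ ∣ Y ─ W ∣)
      codeᴰ = vecCoding setoid (listCoding setoid gs)

      z∈G : ∀ i j → VAll.All (_∈ₛ gs) (select (Y ─ W) (z i j))
      z∈G i j = VAll.universal gs-complete _

      f : Fin (length ys) → Fin (length vs) → Fin (length gs ^ ∣ Y ─ W ∣ * length cs)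
      f i j = combine (Coding.code codeᴰ (z∈G i j)) (index (image∈cs i j))

      z≈x-on-W : ∀ i j {t} → t ∈ W → lookup (z i j) t ≈ lookup (x i) t
      z≈x-on-W i j {t} t∈W = begin
        lookup (z i j) t                    ≡⟨ lookup-zipWith _∙_ t (U j) (x i) ⟩
        lookup (U j) t ∙ lookup (x i) t     ≡⟨ cong (_∙ lookup (x i) t) (lookup-scatter-∉ ε (∁ W) (u j) (x∈p⇒x∉∁p t∈W)) ⟩
        ε ∙ lookup (x i) t                  ≈⟨ identityˡ _ ⟩
        lookup (x i) t                      ∎
        where open import Relation.Binary.Reasoning.Setoid setoid

      A*z≈v : ∀ i j → A *ᴹ z i j ≋ List.lookup vs j
      A*z≈v i j = begin
        A *ᴹ z i j                                          ≈⟨ *ᴹ-distrib-∙ A (U j) (x i) ⟩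
        zipWith _∙_ (A *ᴹ U j) (A *ᴹ x i)                   ≈⟨ PW.zipWith-cong ∙-cong (*ᴹ-scatter (∁ W) A (u j)) (A*x≈ε i) ⟩
        zipWith _∙_ (cols (∁ W) A *ᴹ u j) (replicate l ε)   ≈⟨ PW.zipWith-identityʳ identityʳ _ ⟩
        cols (∁ W) A *ᴹ u j                                 ≈⟨ proj₂ (LAll.lookup vs-images (∈-lookup j)) ⟩
        List.lookup vs j                                    ∎
        where open import Relation.Binary.Reasoning.Setoid (PW.setoid setoid l)

      f-injective : ∀ {i j i′ j′} → f i j ≡ f i′ j′ →
                    List.lookup ys i ≋ List.lookup ys i′ × List.lookup vs j ≋ List.lookup vs j′
      f-injective {i} {j} {i′} {j′} eq = y≈y′ , v≈v′
        where
          eqᴰ : Coding.code codeᴰ (z∈G i j) ≡ Coding.code codeᴰ (z∈G i′ j′)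
          eqᴰ = proj₁ (combine-injective (Coding.code codeᴰ (z∈G i j)) _ _ _ eq)

          eqᶜ : index (image∈cs i j) ≡ index (image∈cs i′ j′)
          eqᶜ = proj₂ (combine-injective (Coding.code codeᴰ (z∈G i j)) _ _ _ eq)

          z-on-Y : ∀ {t} → t ∈ Y → lookup (z i j) t ≈ lookup (z i′ j′) t
          z-on-Y {t} t∈Y with t ∈? W
          ... | yes t∈W = trans (z≈x-on-W i j t∈W) (trans
                (select-pointwise⁻ W (≋-trans (xW≈w0 i) (≋-sym (xW≈w0 i′))) t∈W)
                (sym (z≈x-on-W i′ j′ t∈W)))
          ... | no  t∉W = select-pointwise⁻ (Y ─ W) (Coding.code-injective codeᴰ (z∈G i j) (z∈G i′ j′) eqᴰ)
                            (x∈p∧x∉q⇒x∈p─q t∈Y t∉W)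

          A*z≈A*z′ : A *ᴹ z i j ≋ A *ᴹ z i′ j′
          A*z≈A*z′ = ≋-trans (*ᴹ-split Y A (z i j)) (≋-trans
            (PW.zipWith-cong ∙-cong (*ᴹ-cong (cols Y A) (select-pointwise⁺ Y z-on-Y))
              (Coding.code-injective (listCoding (PW.setoid setoid l) cs) (image∈cs i j) (image∈cs i′ j′) eqᶜ))
            (≋-sym (*ᴹ-split Y A (z i′ j′))))

          v≈v′ : List.lookup vs j ≋ List.lookup vs j′
          v≈v′ = ≋-trans (≋-sym (A*z≈v i j)) (≋-trans A*z≈A*z′ (A*z≈v i′ j′))

          x-on-Y : ∀ {t} → t ∈ Y → lookup (x i) t ≈ lookup (x i′) t
          x-on-Y {t} t∈Y = ∙-cancelˡ (lookup (U j) t) _ _ (begin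
            lookup (U j) t ∙ lookup (x i) t     ≡⟨ lookup-zipWith _∙_ t (U j) (x i) ⟨
            lookup (z i j) t                    ≈⟨ z-on-Y t∈Y ⟩
            lookup (z i′ j′) t                  ≡⟨ lookup-zipWith _∙_ t (U j′) (x i′) ⟩
            lookup (U j′) t ∙ lookup (x i′) t   ≡⟨ cong (λ j → lookup (U j) t ∙ lookup (x i′) t)
                                                     (Unique⇒lookup-injective (PW.setoid setoid l) vs-unique v≈v′) ⟨
            lookup (U j) t ∙ lookup (x i′) t    ∎)
            where open import Relation.Binary.Reasoning.Setoid setoid

          y≈y′ : List.lookup ys i ≋ List.lookup ys i′
          y≈y′ = ≋-trans (≋-sym (xY≈y i)) (≋-trans (select-pointwise⁺ Y x-on-Y) (xY≈y i′))

  solutions-bound : ∀ {n} → Card.HasCard setoid (λ _ → ⊤ {ℓ = c}) n →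
    (l k : ℕ) (A : Vec (Vec ℤ k) l) (W Y : Subset k) → W ⊆ Y →
    (w0 : Vec Carrier ∣ W ∣) (mW mY : ℕ) →
    Card.HasCard (PW.setoid setoid l) (Img (cols (∁ W) A)) mW →
    Card.HasCard (PW.setoid setoid l) (Img (cols (∁ Y) A)) mY →
    (ys : List (Vec Carrier ∣ Y ∣)) → Card.Unique (PW.setoid setoid ∣ Y ∣) ys →
    LAll.All (Sol (λ _ → ⊤ {ℓ = c}) A W Y w0) ys →
    length ys * mW ≤ n ^ (∣ Y ∣ ∸ ∣ W ∣) * mY
  solutions-bound (gs , ≡.refl , _ , _ , gs-complete) l k A W Y W⊆Y w0 _ _
                  (vs , ≡.refl , vs-unique , vs-images , _) (cs , ≡.refl , _ , _ , cs-complete) ys ys-unique sols =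
    ≡.subst (λ e → length ys * length vs ≤ length gs ^ e * length cs) (≡.sym (∣Y∣∸∣W∣≡∣Y─W∣ W⊆Y))
      (solutions*image≤ gs (λ g → gs-complete g tt) A W⊆Y w0 vs-unique vs-images cs-complete ys-unique sols)

-- Matrices over a field

punchIn-or-≡ : (i j : Fin (suc n)) → j ≡ i ⊎ ∃ λ j′ → punchIn i j′ ≡ j
punchIn-or-≡ i j with j ≟ i
... | yes j≡i = inj₁ j≡i
... | no  j≢i = inj₂ (punchOut (j≢i ∘ ≡.sym) , punchIn-punchOut (j≢i ∘ ≡.sym))

module Matrices (F : Field c ℓ) where
  open Field F hiding (zero)
  open import Algebra.Properties.Ring ring using (-1*x≈-x; -‿distribʳ-*; [y-z]x≈yx-zx)
  open import Algebra.Properties.AbelianGroup +-abelianGroup using (ε⁻¹≈ε; inverseˡ-unique)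
  open import Algebra.Properties.Semiring.Sum semiring public
    using (sum; ∑-distrib-+; ∑-comm; sum-remove; *-distribˡ-sum; sum-cong-≋; sum-cong-≗; sum-replicate-zero)
  open import Relation.Binary.Reasoning.Setoid setoid

  Matrix : ℕ → ℕ → Set c
  Matrix m n = Fin m → Fin n → Carrier

  infixr 7 _⊙_
  _⊙_ : Matrix m n → Vector Carrier n → Vector Carrier m
  (H ⊙ δ) r = sum λ i → H r i * δ i

  Null : Vector Carrier n → Set ℓ
  Null δ = ∀ i → δ i ≈ 0#

  TrivialKernel : Matrix m n → Set (c ⊔ ℓ)
  TrivialKernel H = ∀ δ → Null (H ⊙ δ) → Null δ

  -- Field equality need not be decidable, so the kernel may only be trivial up to ¬ ¬.
  WeaklyTrivialKernel : Matrix m n → Set (c ⊔ ℓ)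
  WeaklyTrivialKernel H = ∀ δ → Null (H ⊙ δ) → ∀ i → ¬ ¬ (δ i ≈ 0#)

  sum-Null : {f : Vector Carrier n} → Null f → sum f ≈ 0#
  sum-Null {n} f≈0 = trans (sum-cong-≋ f≈0) (sum-replicate-zero n)

  sum-neg : (f : Vector Carrier n) → sum (λ i → - f i) ≈ - sum f
  sum-neg f = begin
    sum (λ i → - f i)      ≈⟨ sum-cong-≋ (λ i → -1*x≈-x (f i)) ⟨
    sum (λ i → - 1# * f i) ≈⟨ *-distribˡ-sum (- 1#) f ⟨
    - 1# * sum f           ≈⟨ -1*x≈-x (sum f) ⟩
    - sum f                ∎

  ⊙-cong : (H : Matrix m n) {δ δ′ : Vector Carrier n} → (∀ i → δ i ≈ δ′ i) → ∀ r → (H ⊙ δ) r ≈ (H ⊙ δ′) r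
  ⊙-cong H δ≈δ′ r = sum-cong-≋ λ i → *-congˡ (δ≈δ′ i)

  ⊙-Null : (H : Matrix m n) {δ : Vector Carrier n} → Null δ → Null (H ⊙ δ)
  ⊙-Null H δ≈0 r = sum-Null λ i → trans (*-congˡ (δ≈0 i)) (zeroʳ _)

  ⊙-eliminate : (f g δ : Vector Carrier n) (α : Carrier) →
                sum (λ i → (f i - α * g i) * δ i) ≈ sum (λ i → f i * δ i) - α * sum (λ i → g i * δ i)
  ⊙-eliminate f g δ α = begin
    sum (λ i → (f i - α * g i) * δ i)                      ≈⟨ sum-cong-≋ (λ i → [y-z]x≈yx-zx (δ i) (f i) (α * g i)) ⟩
    sum (λ i → f i * δ i - α * g i * δ i)                  ≈⟨ ∑-distrib-+ (λ i → f i * δ i) (λ i → - (α * g i * δ i)) ⟩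
    sum (λ i → f i * δ i) + sum (λ i → - (α * g i * δ i))  ≈⟨ +-congˡ (sum-neg (λ i → α * g i * δ i)) ⟩
    sum (λ i → f i * δ i) - sum (λ i → α * g i * δ i)      ≈⟨ +-congˡ (-‿cong (sum-cong-≋ λ i → *-assoc α (g i) (δ i))) ⟩
    sum (λ i → f i * δ i) - sum (λ i → α * (g i * δ i))    ≈⟨ +-congˡ (-‿cong (*-distribˡ-sum α (λ i → g i * δ i))) ⟨
    sum (λ i → f i * δ i) - α * sum (λ i → g i * δ i)      ∎

  -- One step of Gaussian elimination with the invertible pivot H p j.
  module Pivot (H : Matrix (suc m) (suc n)) (p : Fin (suc m)) (j : Fin (suc n))
               {ρ : Carrier} (pivot : H p j * ρ ≈ 1#) where

    H₋ : Matrix (suc m) n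
    H₋ r i = H r (punchIn j i)

    R : Matrix (suc m) n
    R r i = H₋ r i - H r j * ρ * H₋ p i

    reduced : Matrix m n
    reduced s = R (punchIn p s)

    -- the value at j which makes row p vanish
    back : Vector Carrier n → Carrier
    back δ = - (ρ * (H₋ ⊙ δ) p)

    extend : Vector Carrier n → Vector Carrier (suc n)
    extend δ = insertAt δ j (back δ)

    ⊙-extend : ∀ δ r → (H ⊙ extend δ) r ≈ (R ⊙ δ) r
    ⊙-extend δ r = begin
      (H ⊙ extend δ) r                                      ≈⟨ sum-remove {i = j} (λ i → H r i * extend δ i) ⟩
      H r j * extend δ j + sum (λ i → H₋ r i * extend δ (punchIn j i))
        ≡⟨ ≡.cong₂ (λ x y → H r j * x + y) (insertAt-lookup δ j _)
                   (sum-cong-≗ λ i → cong (H₋ r i *_) (insertAt-punchIn δ j _ i)) ⟩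
      H r j * - (ρ * (H₋ ⊙ δ) p) + (H₋ ⊙ δ) r               ≈⟨ +-comm _ _ ⟩
      (H₋ ⊙ δ) r + H r j * - (ρ * (H₋ ⊙ δ) p)               ≈⟨ +-congˡ (-‿distribʳ-* _ _) ⟨
      (H₋ ⊙ δ) r - H r j * (ρ * (H₋ ⊙ δ) p)                 ≈⟨ +-congˡ (-‿cong (*-assoc _ _ _)) ⟨
      (H₋ ⊙ δ) r - H r j * ρ * (H₋ ⊙ δ) p                   ≈⟨ ⊙-eliminate (H₋ r) (H₋ p) δ (H r j * ρ) ⟨
      (R ⊙ δ) r                                              ∎

    R-pivot-row : ∀ i → R p i ≈ 0#
    R-pivot-row i = begin
      H₋ p i - H p j * ρ * H₋ p i  ≈⟨ +-congˡ (-‿cong (*-congʳ pivot)) ⟩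
      H₋ p i - 1# * H₋ p i         ≈⟨ +-congˡ (-‿cong (*-identityˡ _)) ⟩
      H₋ p i - H₋ p i              ≈⟨ -‿inverseʳ _ ⟩
      0#                           ∎

    pivot-solves : (δ : Vector Carrier (suc n)) → (H ⊙ δ) p ≈ 0# → δ j ≈ back (δ ∘ punchIn j)
    pivot-solves δ row≈0 = begin
      δ j                  ≈⟨ *-identityˡ _ ⟨
      1# * δ j             ≈⟨ *-congʳ (trans (*-comm ρ _) pivot) ⟨
      ρ * H p j * δ j      ≈⟨ *-assoc _ _ _ ⟩
      ρ * (H p j * δ j)    ≈⟨ *-congˡ (inverseˡ-unique _ _ (trans (sym (sum-remove {i = j} (λ i → H p i * δ i))) row≈0)) ⟩
      ρ * - S              ≈⟨ -‿distribʳ-* _ _ ⟨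
      - (ρ * S)            ∎
      where
        S : Carrier
        S = (H₋ ⊙ (δ ∘ punchIn j)) p

    extend-restrict : (δ : Vector Carrier (suc n)) → (H ⊙ δ) p ≈ 0# → ∀ i → extend (δ ∘ punchIn j) i ≈ δ i
    extend-restrict δ row≈0 i with punchIn-or-≡ j i
    ... | inj₁ ≡.refl         = trans (reflexive (insertAt-lookup _ j _)) (sym (pivot-solves δ row≈0))
    ... | inj₂ (i′ , ≡.refl)  = reflexive (insertAt-punchIn _ j _ i′)

    extend-Null : {δ : Vector Carrier n} → Null δ → Null (extend δ)
    extend-Null {δ} δ≈0 i with punchIn-or-≡ j i
    ... | inj₁ ≡.refl        = trans (reflexive (insertAt-lookup δ j _)) (begin
      - (ρ * (H₋ ⊙ δ) p)  ≈⟨ -‿cong (*-congˡ (⊙-Null H₋ δ≈0 p)) ⟩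
      - (ρ * 0#)          ≈⟨ -‿cong (zeroʳ ρ) ⟩
      - 0#                ≈⟨ ε⁻¹≈ε ⟩
      0#                  ∎)
    ... | inj₂ (i′ , ≡.refl) = trans (reflexive (insertAt-punchIn δ j _ i′)) (δ≈0 i′)

    trivialKernel-lift : TrivialKernel reduced → TrivialKernel H
    trivialKernel-lift triv δ Hδ≈0 i =
      trans (sym (extend-restrict δ (Hδ≈0 p) i)) (extend-Null (triv δ₋ (Rδ₋≈0 ∘ punchIn p)) i)
      where
        δ₋ : Vector Carrier n
        δ₋ = δ ∘ punchIn j

        Rδ₋≈0 : Null (R ⊙ δ₋)
        Rδ₋≈0 r = trans (sym (⊙-extend δ₋ r)) (trans (⊙-cong H (extend-restrict δ (Hδ≈0 p)) r) (Hδ≈0 r))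

    weaklyTrivialKernel-reduce : WeaklyTrivialKernel H → WeaklyTrivialKernel reduced
    weaklyTrivialKernel-reduce weak δ redδ≈0 i ¬δi≈0 =
      weak (extend δ) (λ r → trans (⊙-extend δ r) (Rδ≈0 r)) (punchIn j i)
        (¬δi≈0 ∘ trans (reflexive (≡.sym (insertAt-punchIn δ j _ i))))
      where
        Rδ≈0 : Null (R ⊙ δ)
        Rδ≈0 r with punchIn-or-≡ p r
        ... | inj₁ ≡.refl        = sum-Null λ i → trans (*-congʳ (R-pivot-row i)) (zeroˡ _)
        ... | inj₂ (s , ≡.refl)  = redδ≈0 s

  -- Both elimination results below are proved under ¬ ¬, which suffices because their
  -- conclusions are decidable (first) or used only to derive a contradiction (second).
  private
    ¬¬-columns≤rows : (H : Matrix m n) → WeaklyTrivialKernel H → ¬ ¬ (n ≤ m)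
    ¬¬-columns≤rows {m}     {zero}  H weak = return z≤n
    ¬¬-columns≤rows {zero}  {suc n} H weak = λ _ → weak (λ _ → 1#) (λ ()) zero 1≉0
    ¬¬-columns≤rows {suc m} {suc n} H weak = do
      inj₂ (j , Hj≉0) ← ¬¬-decide-∀ (λ j → H zero j ≈ 0#)
        where inj₁ row₀≈0 → λ ¬n≤m → ¬¬-columns≤rows (H ∘ suc) (weak-tail row₀≈0) (¬n≤m ∘ ℕ.m≤n⇒m≤1+n)
      let ρ , pivot = inverse (H zero j) Hj≉0
      n≤m ← ¬¬-columns≤rows (Pivot.reduced H zero j pivot) (Pivot.weaklyTrivialKernel-reduce H zero j pivot weak)
      return (s≤s n≤m)
      where
        weak-tail : (∀ j → H zero j ≈ 0#) → WeaklyTrivialKernel (H ∘ suc)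
        weak-tail row₀≈0 δ Hδ≈0 = weak δ λ
          { zero    → sum-Null {f = λ i → H zero i * δ i} λ i → trans (*-congʳ (row₀≈0 i)) (zeroˡ _)
          ; (suc r) → Hδ≈0 r
          }

  weaklyTrivialKernel⇒columns≤rows : (H : Matrix m n) → WeaklyTrivialKernel H → n ≤ m
  weaklyTrivialKernel⇒columns≤rows H weak = decidable-stable (_ ≤? _) (¬¬-columns≤rows H weak)

  weaklyTrivialKernel⇒¬¬trivialKernel : (H : Matrix m n) → WeaklyTrivialKernel H → ¬ ¬ TrivialKernel H
  weaklyTrivialKernel⇒¬¬trivialKernel {m}     {zero}  H weak = return λ δ _ ()
  weaklyTrivialKernel⇒¬¬trivialKernel {zero}  {suc n} H weak = λ _ → weak (λ _ → 1#) (λ ()) zero 1≉0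
  weaklyTrivialKernel⇒¬¬trivialKernel {suc m} {suc n} H weak = do
    inj₂ (p , Hp≉0) ← ¬¬-decide-∀ (λ r → H r zero ≈ 0#)
      where inj₁ col₀≈0 → λ _ → weak e₀ (He₀≈0 col₀≈0) zero 1≉0
    let ρ , pivot = inverse (H p zero) Hp≉0
    triv ← weaklyTrivialKernel⇒¬¬trivialKernel (Pivot.reduced H p zero pivot)
             (Pivot.weaklyTrivialKernel-reduce H p zero pivot weak)
    return (Pivot.trivialKernel-lift H p zero pivot triv)
    where
      e₀ : Vector Carrier (suc n)
      e₀ zero    = 1#
      e₀ (suc i) = 0#

      He₀≈0 : (∀ r → H r zero ≈ 0#) → Null (H ⊙ e₀)
      He₀≈0 col₀≈0 r = trans (+-cong (trans (*-identityʳ _) (col₀≈0 r))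
                                     (sum-Null {f = λ i → H r (suc i) * 0#} λ i → zeroʳ _))
                              (+-identityʳ 0#)

  ⊙-+ : (H : Matrix m n) (δ δ′ : Vector Carrier n) → ∀ r → (H ⊙ (λ t → δ t + δ′ t)) r ≈ (H ⊙ δ) r + (H ⊙ δ′) r
  ⊙-+ H δ δ′ r = trans (sum-cong-≋ λ t → distribˡ (H r t) (δ t) (δ′ t)) (∑-distrib-+ (λ t → H r t * δ t) (λ t → H r t * δ′ t))

  ⊙-* : (H : Matrix m n) (α : Carrier) (δ : Vector Carrier n) → ∀ r → (H ⊙ (λ t → α * δ t)) r ≈ α * (H ⊙ δ) r
  ⊙-* H α δ r = begin
    sum (λ t → H r t * (α * δ t))  ≈⟨ sum-cong-≋ (λ t → x∙yz≈y∙xz (H r t) α (δ t)) ⟩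
    sum (λ t → α * (H r t * δ t))  ≈⟨ *-distribˡ-sum α (λ t → H r t * δ t) ⟨
    α * (H ⊙ δ) r                  ∎
    where open import Algebra.Properties.CommutativeSemigroup *-commutativeSemigroup using (x∙yz≈y∙xz)

  ⊙-− : (H : Matrix m n) (u w : Vector Carrier n) → ∀ r → (H ⊙ (λ t → u t - w t)) r ≈ (H ⊙ u) r - (H ⊙ w) r
  ⊙-− H u w r = begin
    (H ⊙ (λ t → u t - w t)) r                ≈⟨ ⊙-+ H u (λ t → - w t) r ⟩
    (H ⊙ u) r + sum (λ t → H r t * - w t)    ≈⟨ +-congˡ (sum-cong-≋ λ t → -‿distribʳ-* (H r t) (w t)) ⟨
    (H ⊙ u) r + sum (λ t → - (H r t * w t))  ≈⟨ +-congˡ (sum-neg (λ t → H r t * w t)) ⟩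
    (H ⊙ u) r - (H ⊙ w) r                    ∎

  ⊙-sum : (H : Matrix m k) (γ : Fin n → Vector Carrier k) (δ : Vector Carrier n) →
          ∀ r → (H ⊙ (λ t → sum λ a → γ a t * δ a)) r ≈ sum (λ a → (H ⊙ γ a) r * δ a)
  ⊙-sum H γ δ r = begin
    sum (λ t → H r t * sum (λ a → γ a t * δ a))    ≈⟨ sum-cong-≋ (λ t → *-distribˡ-sum (H r t) (λ a → γ a t * δ a)) ⟩
    sum (λ t → sum (λ a → H r t * (γ a t * δ a)))  ≈⟨ ∑-comm (λ t a → H r t * (γ a t * δ a)) ⟩
    sum (λ a → sum (λ t → H r t * (γ a t * δ a)))  ≈⟨ sum-cong-≋ (λ a → sum-cong-≋ λ t → *-assoc (H r t) (γ a t) (δ a)) ⟨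
    sum (λ a → sum (λ t → H r t * γ a t * δ a))    ≈⟨ sum-cong-≋ (λ a → *-distribʳ-sum (δ a) (λ t → H r t * γ a t)) ⟨
    sum (λ a → (H ⊙ γ a) r * δ a)                  ∎
    where open import Algebra.Properties.Semiring.Sum semiring using (*-distribʳ-sum)

  unit : Fin n → Vector Carrier n
  unit i t with t ≟ i
  ... | yes _ = 1#
  ... | no  _ = 0#

  unit-self : (i : Fin n) → unit i i ≈ 1#
  unit-self i with i ≟ i
  ... | yes _   = refl
  ... | no  i≢i = contradiction ≡.refl i≢i

  unit-other : {i t : Fin n} → t ≢ i → unit i t ≈ 0#
  unit-other {i = i} {t} t≢i with t ≟ i
  ... | yes t≡i = contradiction t≡i t≢i
  ... | no  _   = refl

  ⊙-unit : (H : Matrix m n) (i : Fin n) → ∀ r → (H ⊙ unit i) r ≈ H r i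
  ⊙-unit {n = suc n} H i r = begin
    (H ⊙ unit i) r                                            ≈⟨ sum-remove {i = i} (λ t → H r t * unit i t) ⟩
    H r i * unit i i + sum (λ t → H r (punchIn i t) * unit i (punchIn i t))
      ≈⟨ +-cong (*-congˡ (unit-self i)) (sum-Null λ t → trans (*-congˡ (unit-other (punchInᵢ≢i i t))) (zeroʳ _)) ⟩
    H r i * 1# + 0#                                           ≈⟨ +-identityʳ _ ⟩
    H r i * 1#                                                ≈⟨ *-identityʳ _ ⟩
    H r i                                                     ∎

  sum-scatter : (S : Subset k) (g : Vector Carrier k) (v : Vec Carrier ∣ S ∣) →
                sum (λ t → g t * lookup (scatter 0# S v) t) ≈ sum (λ i → g (enum S i) * lookup v i)
  sum-scatter []          g []       = refl
  sum-scatter (true  ∷ S) g (x ∷ v)  = +-congˡ (sum-scatter S (g ∘ suc) v)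
  sum-scatter (false ∷ S) g v        =
    trans (+-congʳ (zeroʳ _)) (trans (+-identityˡ _) (sum-scatter S (g ∘ suc) v))

  module Columns (M : Matrix l k) where

    column : Fin k → Vector Carrier l
    column t r = M r t

    Supported : Subset k → Vector Carrier k → Set ℓ
    Supported S δ = ∀ {t} → t ∉ S → δ t ≈ 0#

    Independent : Subset k → Set (c ⊔ ℓ)
    Independent S = ∀ δ → Supported S δ → Null (M ⊙ δ) → Null δ

    infix 4 _∈span_
    _∈span_ : Vector Carrier l → Subset k → Set (c ⊔ ℓ)
    v ∈span S = ∃ λ γ → Supported S γ × ∀ r → (M ⊙ γ) r ≈ v r

    columnsOf : (S : Subset k) → Matrix l ∣ S ∣
    columnsOf S r i = M r (enum S i)

    spread : (S : Subset k) → Vector Carrier ∣ S ∣ → Vector Carrier k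
    spread S c = lookup (scatter 0# S (tabulate c))

    restrict : Subset k → Vector Carrier k → Vector Carrier k
    restrict S δ = spread S (δ ∘ enum S)

    spread-enum : (S : Subset k) (c : Vector Carrier ∣ S ∣) (i : Fin ∣ S ∣) → spread S c (enum S i) ≡ c i
    spread-enum S c i = ≡.trans (lookup-scatter-enum 0# S (tabulate c) i) (lookup∘tabulate c i)

    spread-Supported : (S : Subset k) (c : Vector Carrier ∣ S ∣) → Supported S (spread S c)
    spread-Supported S c t∉S = reflexive (lookup-scatter-∉ 0# S (tabulate c) t∉S)

    restrict-∈ : {S : Subset k} (δ : Vector Carrier k) {t : Fin k} → t ∈ S → restrict S δ t ≡ δ t
    restrict-∈ {S} δ t∈S with i , ≡.refl ← ∈⇒≡enum t∈S = spread-enum S (δ ∘ enum S) i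

    restrict-Supported : (S : Subset k) (δ : Vector Carrier k) → Supported S (restrict S δ)
    restrict-Supported S δ = spread-Supported S (δ ∘ enum S)

    Supported⇒≈restrict : {S : Subset k} {δ : Vector Carrier k} → Supported S δ → ∀ t → δ t ≈ restrict S δ t
    Supported⇒≈restrict {S} {δ} supp t with t ∈? S
    ... | yes t∈S = reflexive (≡.sym (restrict-∈ δ t∈S))
    ... | no  t∉S = trans (supp t∉S) (sym (restrict-Supported S δ t∉S))

    ⊙-spread : (S : Subset k) (c : Vector Carrier ∣ S ∣) → ∀ r → (M ⊙ spread S c) r ≈ (columnsOf S ⊙ c) r
    ⊙-spread S c r = trans (sum-scatter S (M r) (tabulate c))
                           (sum-cong-≋ λ i → *-congˡ (reflexive (lookup∘tabulate c i)))

    spread-Null : (S : Subset k) {c : Vector Carrier ∣ S ∣} → Null c → Null (spread S c)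
    spread-Null S {c} c≈0 t with t ∈? S
    ... | yes t∈S with i , ≡.refl ← ∈⇒≡enum t∈S = trans (reflexive (spread-enum S c i)) (c≈0 i)
    ... | no  t∉S = spread-Supported S c t∉S

    trivialKernel⇒independent : (S : Subset k) → TrivialKernel (columnsOf S) → Independent S
    trivialKernel⇒independent S triv δ supp Mδ≈0 t =
      trans (Supported⇒≈restrict supp t) (spread-Null S (triv (δ ∘ enum S) columns⊙δ≈0) t)
      where
        columns⊙δ≈0 : Null (columnsOf S ⊙ (δ ∘ enum S))
        columns⊙δ≈0 r = trans (sym (⊙-spread S (δ ∘ enum S) r))
                          (trans (sym (⊙-cong M (Supported⇒≈restrict supp) r)) (Mδ≈0 r))

    WeaklyIndependent : Subset k → Set (c ⊔ ℓ)
    WeaklyIndependent S = ∀ δ → Supported S δ → Null (M ⊙ δ) → ∀ t → ¬ ¬ (δ t ≈ 0#)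

    weaklyIndependent⇒¬¬independent : (S : Subset k) → WeaklyIndependent S → ¬ ¬ Independent S
    weaklyIndependent⇒¬¬independent S weak = do
      triv ← weaklyTrivialKernel⇒¬¬trivialKernel (columnsOf S) weakKernel
      return (trivialKernel⇒independent S triv)
      where
        weakKernel : WeaklyTrivialKernel (columnsOf S)
        weakKernel c Sc≈0 i ci≉0 =
          weak (spread S c) (spread-Supported S c) (λ r → trans (⊙-spread S c r) (Sc≈0 r)) (enum S i)
               (ci≉0 ∘ trans (reflexive (≡.sym (spread-enum S c i))))

    column∈span : {S : Subset k} {i : Fin k} → i ∈ S → column i ∈span S
    column∈span {S} {i} i∈S = unit i , (λ {t} t∉S → unit-other {i = i} {t} λ { ≡.refl → t∉S i∈S }) , ⊙-unit M i

    ∈span-mono : {S T : Subset k} → S ⊆ T → ∀ {v} → v ∈span S → v ∈span T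
    ∈span-mono {S} {T} S⊆T (γ , supp , Mγ≈v) = γ , (λ t∉T → supp (t∉T ∘ S⊆T)) , Mγ≈v

    ⊙-∈span : {U S : Subset k} → (∀ {t} → t ∈ U → column t ∈span S) →
              ∀ {δ} → Supported U δ → (M ⊙ δ) ∈span S
    ⊙-∈span {U} {S} spans {δ} supp = Γ , Γ-Supported , MΓ≈Mδ
      where
        γ : Fin k → Vector Carrier k
        γ t with t ∈? U
        ... | yes t∈U = proj₁ (spans t∈U)
        ... | no  _   = λ _ → 0#

        γ-Supported : ∀ t → Supported S (γ t)
        γ-Supported t with t ∈? U
        ... | yes t∈U = proj₁ (proj₂ (spans t∈U))
        ... | no  _   = λ _ → refl

        -- γ t spans column t only for t ∈ U, but δ vanishes outside U
        γ-spans : ∀ r t → δ t * (M ⊙ γ t) r ≈ δ t * M r t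
        γ-spans r t with t ∈? U
        ... | yes t∈U = *-congˡ (proj₂ (proj₂ (spans t∈U)) r)
        ... | no  t∉U = trans (*-congʳ (supp t∉U)) (trans (zeroˡ _) (sym (trans (*-congʳ (supp t∉U)) (zeroˡ _))))

        Γ : Vector Carrier k
        Γ j = sum λ t → γ t j * δ t

        Γ-Supported : Supported S Γ
        Γ-Supported j∉S = sum-Null λ t → trans (*-congʳ (γ-Supported t j∉S)) (zeroˡ _)

        MΓ≈Mδ : ∀ r → (M ⊙ Γ) r ≈ (M ⊙ δ) r
        MΓ≈Mδ r = begin
          (M ⊙ Γ) r                       ≈⟨ ⊙-sum M γ δ r ⟩
          sum (λ t → (M ⊙ γ t) r * δ t)   ≈⟨ sum-cong-≋ (λ t → trans (*-comm _ _) (trans (γ-spans r t) (*-comm _ _))) ⟩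
          (M ⊙ δ) r                       ∎

    ∣independent∣≤∣spanning∣ : {S T : Subset k} → Independent S → (∀ {t} → t ∈ S → column t ∈span T) →
                              ∣ S ∣ ≤ ∣ T ∣
    ∣independent∣≤∣spanning∣ {S} {T} indS spans =
      weaklyTrivialKernel⇒columns≤rows H λ δ Hδ≈0 a ¬δa≈0 → ¬δa≈0 (δ≈0 δ Hδ≈0 a)
      where
        γ : Fin ∣ S ∣ → Vector Carrier k
        γ a = proj₁ (spans (enum-∈ S a))

        -- the columns of S in coordinates along T
        H : Matrix ∣ T ∣ ∣ S ∣
        H t a = γ a (enum T t)

        δ≈0 : ∀ δ → Null (H ⊙ δ) → Null δ
        δ≈0 δ Hδ≈0 a = trans (reflexive (≡.sym (spread-enum S δ a)))
                             (indS (spread S δ) (spread-Supported S δ) Mδ≈0 (enum S a))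
          where
            φ : Vector Carrier k
            φ j = sum λ a → γ a j * δ a

            φ-Supported : Supported T φ
            φ-Supported t∉T = sum-Null λ a → trans (*-congʳ (proj₁ (proj₂ (spans (enum-∈ S a))) t∉T)) (zeroˡ _)

            φ≈0 : Null φ
            φ≈0 t = trans (Supported⇒≈restrict φ-Supported t) (spread-Null T Hδ≈0 t)

            Mδ≈0 : Null (M ⊙ spread S δ)
            Mδ≈0 r = begin
              (M ⊙ spread S δ) r                ≈⟨ ⊙-spread S δ r ⟩
              sum (λ a → M r (enum S a) * δ a)  ≈⟨ sum-cong-≋ (λ a → *-congʳ (proj₂ (proj₂ (spans (enum-∈ S a))) r)) ⟨
              sum (λ a → (M ⊙ γ a) r * δ a)     ≈⟨ ⊙-sum M γ δ r ⟨
              (M ⊙ φ) r                         ≈⟨ ⊙-Null M φ≈0 r ⟩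
              0#                                ∎

    ∉span⇒¬¬independent-∪ : {S : Subset k} {i : Fin k} → Independent S → ¬ (column i ∈span S) →
                             ¬ ¬ Independent (S ∪ ⁅ i ⁆)
    ∉span⇒¬¬independent-∪ {S} {i} indS i∉span = weaklyIndependent⇒¬¬independent (S ∪ ⁅ i ⁆) weak
      where
        weak : WeaklyIndependent (S ∪ ⁅ i ⁆)
        weak δ supp Mδ≈0 t = do
          yes δi≈0 ← ¬¬-excluded-middle
            where no δi≉0 → contradiction (column-i∈span δi≉0) i∉span
          return (indS δ (Supported-S δi≈0) Mδ≈0 t)
          where
            ∉S∪i : ∀ {t} → t ∉ S → t ≢ i → t ∉ S ∪ ⁅ i ⁆
            ∉S∪i t∉S t≢i = [ t∉S , t≢i ∘ x∈⁅y⁆⇒x≡y i ] ∘ x∈p∪q⁻ S ⁅ i ⁆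

            Supported-S : δ i ≈ 0# → Supported S δ
            Supported-S δi≈0 {t} t∉S with t ≟ i
            ... | yes ≡.refl = δi≈0
            ... | no  t≢i    = supp (∉S∪i t∉S t≢i)

            -- unit i - δ / δ i is supported on S and maps to column i
            column-i∈span : ¬ δ i ≈ 0# → column i ∈span S
            column-i∈span δi≉0 = γ , γ-Supported , Mγ≈column
              where
                η : Carrier
                η = proj₁ (inverse (δ i) δi≉0)

                γ : Vector Carrier k
                γ t = unit i t - η * δ t

                γ-Supported : Supported S γ
                γ-Supported {t} t∉S with toSum (t ≟ i)
                ... | inj₁ ≡.refl = begin
                  unit t t - η * δ t  ≈⟨ +-cong (unit-self t) (-‿cong (trans (*-comm _ _) (proj₂ (inverse (δ t) δi≉0)))) ⟩
                  1# - 1#             ≈⟨ -‿inverseʳ 1# ⟩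
                  0#                  ∎
                ... | inj₂ t≢i = begin
                  unit i t - η * δ t  ≈⟨ +-cong (unit-other t≢i) (-‿cong (*-congˡ (supp (∉S∪i t∉S t≢i)))) ⟩
                  0# - η * 0#         ≈⟨ +-congˡ (-‿cong (zeroʳ η)) ⟩
                  0# - 0#             ≈⟨ -‿inverseʳ 0# ⟩
                  0#                  ∎

                Mγ≈column : ∀ r → (M ⊙ γ) r ≈ M r i
                Mγ≈column r = begin
                  (M ⊙ γ) r                                 ≈⟨ ⊙-− M (unit i) (λ t → η * δ t) r ⟩
                  (M ⊙ unit i) r - (M ⊙ (λ t → η * δ t)) r  ≈⟨ +-congˡ (-‿cong (⊙-* M η δ r)) ⟩
                  (M ⊙ unit i) r - η * (M ⊙ δ) r            ≈⟨ +-cong (⊙-unit M i r) (-‿cong (*-congˡ (Mδ≈0 r))) ⟩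
                  M r i - η * 0#                            ≈⟨ +-congˡ (trans (-‿cong (zeroʳ η)) ε⁻¹≈ε) ⟩
                  M r i + 0#                                ≈⟨ +-identityʳ _ ⟩
                  M r i                                     ∎

    record MaximumIndependent (Q S : Subset k) : Set (c ⊔ ℓ) where
      field
        ⊆Q          : S ⊆ Q
        independent : Independent S
        maximum     : ∀ {S′} → S′ ⊆ Q → Independent S′ → ∣ S′ ∣ ≤ ∣ S ∣

    maximumIndependent⇒∈span : {Q S : Subset k} → MaximumIndependent Q S → ∀ {i} → i ∈ Q → ¬ ¬ column i ∈span S
    maximumIndependent⇒∈span {Q} {S} max {i} i∈Q with i ∈? S
    ... | yes i∈S = return (column∈span i∈S)
    ... | no  i∉S = λ i∉span → ∉span⇒¬¬independent-∪ independent i∉span λ indS∪i →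
          ℕ.<-irrefl ≡.refl (≡.subst (_≤ ∣ S ∣) (∣p∪⁅i⁆∣≡1+∣p∣ S i∉S) (maximum S∪i⊆Q indS∪i))
      where
        open MaximumIndependent max
        S∪i⊆Q : S ∪ ⁅ i ⁆ ⊆ Q
        S∪i⊆Q t∈S∪i with x∈p∪q⁻ S ⁅ i ⁆ t∈S∪i
        ... | inj₁ t∈S = ⊆Q t∈S
        ... | inj₂ t∈i with ≡.refl ← x∈⁅y⁆⇒x≡y i t∈i = i∈Q

    extend-spanning : (cs : List (Fin k)) {T : Subset k} → Independent T →
      ¬ ¬ ∃ λ T′ → Independent T′ × T ⊆ T′ × (∀ {t} → t ∈ T′ → t ∈ T ⊎ t ∈ˡ cs) ×
                    (∀ {t} → t ∈ˡ cs → column t ∈span T′)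
    extend-spanning []       {T} indT = λ ¬extension → ¬extension (T , indT , ⊆-refl , inj₁ , λ ())
    extend-spanning (c ∷ cs) {T} indT ¬extension = ¬¬-excluded-middle λ where
        (yes indT∪c) → extend-spanning cs indT∪c λ (T′ , indT′ , T∪c⊆T′ , T′⊆ , spans) →
          ¬extension (T′ , indT′ , (λ t∈T → T∪c⊆T′ (x∈p∪q⁺ (inj₁ t∈T))) , (λ t∈T′ → from-T∪c (T′⊆ t∈T′)) ,
            λ { (here ≡.refl) → column∈span (T∪c⊆T′ (x∈p∪q⁺ (inj₂ (x∈⁅x⁆ c)))) ; (there t∈cs) → spans t∈cs })
        (no ¬indT∪c) → dependent⇒∈span ¬indT∪c λ c∈spanT → extend-spanning cs indT λ (T′ , indT′ , T⊆T′ , T′⊆ , spans) →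
          ¬extension (T′ , indT′ , T⊆T′ , (λ t∈T′ → Sum.map₂ there (T′⊆ t∈T′)) ,
            λ { (here ≡.refl) → ∈span-mono T⊆T′ c∈spanT ; (there t∈cs) → spans t∈cs })
      where
        dependent⇒∈span : ¬ Independent (T ∪ ⁅ c ⁆) → ¬ ¬ column c ∈span T
        dependent⇒∈span ¬indT∪c c∉spanT = ∉span⇒¬¬independent-∪ indT c∉spanT ¬indT∪c

        from-T∪c : ∀ {t} → t ∈ T ∪ ⁅ c ⁆ ⊎ t ∈ˡ cs → t ∈ T ⊎ t ∈ˡ c ∷ cs
        from-T∪c (inj₂ t∈cs) = inj₂ (there t∈cs)
        from-T∪c {t} (inj₁ t∈T∪c) with x∈p∪q⁻ T ⁅ c ⁆ t∈T∪c
        ... | inj₁ t∈T = inj₁ t∈T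
        ... | inj₂ t∈c = inj₂ (here (x∈⁅y⁆⇒x≡y c t∈c))

    restrict-split : (S : Subset k) (δ : Vector Carrier k) → ∀ t → δ t ≈ restrict S δ t + restrict (∁ S) δ t
    restrict-split S δ t with t ∈? S
    ... | yes t∈S = sym (trans (+-cong (reflexive (restrict-∈ δ t∈S)) (restrict-Supported (∁ S) δ (x∈p⇒x∉∁p t∈S)))
                               (+-identityʳ _))
    ... | no  t∉S = sym (trans (+-cong (restrict-Supported S δ t∉S) (reflexive (restrict-∈ δ (x∉p⇒x∈∁p t∉S))))
                               (+-identityˡ _))

    Determines : Subset k → Subset k → Set (c ⊔ ℓ)
    Determines P Y = ∀ δ → Null (M ⊙ δ) → (∀ {t} → t ∈ P → δ t ≈ 0#) → ∀ {t} → t ∈ Y → δ t ≈ 0#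

    determines-mono : {P P′ Y : Subset k} → P ⊆ P′ → Determines P Y → Determines P′ Y
    determines-mono P⊆P′ det δ Mδ≈0 δ≈0-on-P′ = det δ Mδ≈0 (δ≈0-on-P′ ∘ P⊆P′)

    -- If SY ⊆ ∁ Y spans the columns of ∁ Y and extends to an independent T, then a kernel
    -- vector vanishing on W and on the part of Y ─ W outside T vanishes on Y: its Y-part
    -- plus an SY-combination replacing its ∁ Y-part is a kernel vector supported on T.
    determines-─ : {W Y SY T : Subset k} → SY ⊆ ∁ Y → (∀ {t} → t ∈ ∁ Y → column t ∈span SY) →
                   SY ⊆ T → Independent T → Determines (W ∪ (Y ─ W ─ T)) Y
    determines-─ {W} {Y} {SY} {T} SY⊆∁Y spans SY⊆T indT δ Mδ≈0 δ≈0-on-P {t} t∈Y = begin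
      δ t                      ≡⟨ restrict-∈ δ t∈Y ⟨
      restrict Y δ t           ≈⟨ +-identityʳ _ ⟨
      restrict Y δ t + 0#      ≈⟨ +-congˡ (γ-Supported (x∈p⇒x∉∁p t∈Y ∘ SY⊆∁Y)) ⟨
      δ″ t                     ≈⟨ indT δ″ δ″-Supported Mδ″≈0 t ⟩
      0#                       ∎
      where
        γ-in-span : (M ⊙ restrict (∁ Y) δ) ∈span SY
        γ-in-span = ⊙-∈span spans (restrict-Supported (∁ Y) δ)

        γ : Vector Carrier k
        γ = proj₁ γ-in-span

        γ-Supported : Supported SY γ
        γ-Supported = proj₁ (proj₂ γ-in-span)

        δ″ : Vector Carrier k
        δ″ t = restrict Y δ t + γ t

        δ″-Supported : Supported T δ″
        δ″-Supported {t} t∉T = trans (+-cong δY≈0 (γ-Supported (t∉T ∘ SY⊆T))) (+-identityʳ 0#)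
          where
            δY≈0 : restrict Y δ t ≈ 0#
            δY≈0 with t ∈? Y | t ∈? W
            ... | no  t∉Y | _       = restrict-Supported Y δ t∉Y
            ... | yes t∈Y | yes t∈W = trans (reflexive (restrict-∈ δ t∈Y)) (δ≈0-on-P (x∈p∪q⁺ (inj₁ t∈W)))
            ... | yes t∈Y | no  t∉W = trans (reflexive (restrict-∈ δ t∈Y))
                (δ≈0-on-P (x∈p∪q⁺ (inj₂ (x∈p∧x∉q⇒x∈p─q (x∈p∧x∉q⇒x∈p─q t∈Y t∉W) t∉T))))

        Mδ″≈0 : Null (M ⊙ δ″)
        Mδ″≈0 r = begin
          (M ⊙ δ″) r                                    ≈⟨ ⊙-+ M (restrict Y δ) γ r ⟩
          (M ⊙ restrict Y δ) r + (M ⊙ γ) r              ≈⟨ +-congˡ (proj₂ (proj₂ γ-in-span) r) ⟩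
          (M ⊙ restrict Y δ) r + (M ⊙ restrict (∁ Y) δ) r ≈⟨ ⊙-+ M (restrict Y δ) (restrict (∁ Y) δ) r ⟨
          (M ⊙ (λ t → restrict Y δ t + restrict (∁ Y) δ t)) r ≈⟨ ⊙-cong M (restrict-split Y δ) r ⟨
          (M ⊙ δ) r                                     ≈⟨ Mδ≈0 r ⟩
          0#                                            ∎

    determining-subset : {W Y SW SY : Subset k} → W ⊆ Y →
      MaximumIndependent (∁ W) SW → MaximumIndependent (∁ Y) SY →
      ¬ ¬ (∣ SW ∣ ≤ ∣ Y ─ W ∣ ℕ.+ ∣ SY ∣ ×
           ∃ λ Q → Q ⊆ Y ─ W × ∣ Q ∣ ≡ ∣ Y ─ W ∣ ℕ.+ ∣ SY ∣ ∸ ∣ SW ∣ × Determines (W ∪ Q) Y)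
    determining-subset {W} {Y} {SW} {SY} W⊆Y maxW maxY ¬goal =
      ¬¬-∀ (λ t → spans-∁Y t) λ spansY →
      extend-spanning (filter (_∈? Y ─ W) (allFin k)) (MaximumIndependent.independent maxY)
        λ (T , indT , SY⊆T , T⊆ , spansD) → ¬goal (goal spansY T indT SY⊆T T⊆ spansD)
      where
        module SW = MaximumIndependent maxW
        module SY = MaximumIndependent maxY

        D : Subset k
        D = Y ─ W

        e : ℕ
        e = ∣ D ∣ ℕ.+ ∣ SY ∣ ∸ ∣ SW ∣

        spans-∁Y : ∀ t → ¬ ¬ (t ∈ ∁ Y → column t ∈span SY)
        spans-∁Y t with t ∈? ∁ Y
        ... | yes t∈∁Y = ¬¬-map (λ t∈span _ → t∈span) (maximumIndependent⇒∈span maxY t∈∁Y)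
        ... | no  t∉∁Y = return (λ t∈∁Y → contradiction t∈∁Y t∉∁Y)

        goal : (∀ t → t ∈ ∁ Y → column t ∈span SY) →
               ∀ T → Independent T → SY ⊆ T → (∀ {t} → t ∈ T → t ∈ SY ⊎ t ∈ˡ filter (_∈? D) (allFin k)) →
               (∀ {t} → t ∈ˡ filter (_∈? D) (allFin k) → column t ∈span T) →
               ∣ SW ∣ ≤ ∣ D ∣ ℕ.+ ∣ SY ∣ × ∃ λ Q → Q ⊆ D × ∣ Q ∣ ≡ e × Determines (W ∪ Q) Y
        goal spansY T indT SY⊆T T⊆ spansD =
          ℕ.m+n≤o⇒m≤o ∣ SW ∣ (≡.subst (_≤ ∣ D ∣ ℕ.+ ∣ SY ∣) (ℕ.+-comm ∣ D ─ T ∣ ∣ SW ∣) count) ,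
          Q , Q⊆D , ∣Q∣≡e ,
          determines-mono (λ t∈ → [ x∈p∪q⁺ ∘ inj₁ , x∈p∪q⁺ ∘ inj₂ ∘ D─T⊆Q ] (x∈p∪q⁻ W (D ─ T) t∈))
            (determines-─ SY.⊆Q (λ {t} → spansY t) SY⊆T indT)
          where
            T⊆SY∪D : T ⊆ SY ∪ D
            T⊆SY∪D t∈T = x∈p∪q⁺ (Sum.map₂ (proj₂ ∘ ∈-filter⁻ (_∈? D) {xs = allFin k}) (T⊆ t∈T))

            spans-SW : ∀ {t} → t ∈ SW → column t ∈span T
            spans-SW {t} t∈SW with t ∈? Y
            ... | yes t∈Y = spansD (∈-filter⁺ (_∈? D) (∈-allFin t) (x∈p∧x∉q⇒x∈p─q t∈Y (x∈∁p⇒x∉p (SW.⊆Q t∈SW))))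
            ... | no  t∉Y = ∈span-mono SY⊆T (spansY t (x∉p⇒x∈∁p t∉Y))

            count : ∣ D ─ T ∣ ℕ.+ ∣ SW ∣ ≤ ∣ D ∣ ℕ.+ ∣ SY ∣
            count = ℕ.≤-trans (ℕ.+-monoʳ-≤ ∣ D ─ T ∣ (∣independent∣≤∣spanning∣ SW.independent spans-SW))
              (≡.subst₂ _≤_ (ℕ.+-comm ∣ T ∣ ∣ D ─ T ∣) (ℕ.+-comm ∣ SY ∣ ∣ D ∣) (∣p∣+∣q─p∣≤∣r∣+∣q∣ T⊆SY∪D))

            e≤∣D∣ : e ≤ ∣ D ∣
            e≤∣D∣ = ≡.subst (e ≤_) (ℕ.m+n∸n≡m ∣ D ∣ ∣ SY ∣)
                      (ℕ.∸-monoʳ-≤ (∣ D ∣ ℕ.+ ∣ SY ∣) (SW.maximum (p⊆q⇒∁p⊇∁q W⊆Y ∘ SY.⊆Q) SY.independent))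

            interpolant : ∃ λ Q → D ─ T ⊆ Q × Q ⊆ D × ∣ Q ∣ ≡ e
            interpolant = ⊆-interpolate (p─q⊆p D T) e (ℕ.m+n≤o⇒m≤o∸n ∣ D ─ T ∣ count) e≤∣D∣

            Q : Subset k
            Q = proj₁ interpolant

            D─T⊆Q : D ─ T ⊆ Q
            D─T⊆Q = proj₁ (proj₂ interpolant)

            Q⊆D : Q ⊆ D
            Q⊆D = proj₁ (proj₂ (proj₂ interpolant))

            ∣Q∣≡e : ∣ Q ∣ ≡ e
            ∣Q∣≡e = proj₂ (proj₂ (proj₂ interpolant))

-- Integer matrices over a field

module IntegerMatrixOverField (F : Field c ℓ) where
  open Field F hiding (zero)
  open FieldRank F
  open Matrices F
  open import Relation.Binary.Reasoning.Setoid setoid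
  open import Algebra.Properties.Ring ring using (-‿distribˡ-*)
  open import Data.Integer using (+_; -[1+_])
  private module Fᶻ = ZAction +-rawGroupF

  toFMatrix : Vec (Vec ℤ k) l → Matrix l k
  toFMatrix A r t = toF (lookup (lookup A r) t)

  foldr-zipWith-* : (xs ys : Vec Carrier n) → foldr′ _+_ 0# (zipWith _*_ xs ys) ≈ sum (λ i → lookup xs i * lookup ys i)
  foldr-zipWith-* []       []       = refl
  foldr-zipWith-* (x ∷ xs) (y ∷ ys) = +-congˡ (foldr-zipWith-* xs ys)

  module Coordinates (d : ℕ) where
    private module Fᵈ = ZAction (vecRawGroup d)

    ×ₙ-lookup : ∀ n (v : Vec Carrier d) ρ → lookup (n Fᵈ.×ₙ v) ρ ≈ (n Fᶻ.×ₙ 1#) * lookup v ρ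
    ×ₙ-lookup zero    v ρ = trans (reflexive (lookup-replicate ρ 0#)) (sym (zeroˡ _))
    ×ₙ-lookup (suc n) v ρ = begin
      lookup (zipWith _+_ v (n Fᵈ.×ₙ v)) ρ             ≡⟨ lookup-zipWith _+_ ρ v (n Fᵈ.×ₙ v) ⟩
      lookup v ρ + lookup (n Fᵈ.×ₙ v) ρ                ≈⟨ +-cong (sym (*-identityˡ _)) (×ₙ-lookup n v ρ) ⟩
      1# * lookup v ρ + (n Fᶻ.×ₙ 1#) * lookup v ρ      ≈⟨ distribʳ _ _ _ ⟨
      (1# + n Fᶻ.×ₙ 1#) * lookup v ρ                   ∎

    ·-lookup : ∀ z (v : Vec Carrier d) ρ → lookup (z Fᵈ.· v) ρ ≈ toF z * lookup v ρ
    ·-lookup (+ n)    v ρ = ×ₙ-lookup n v ρ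
    ·-lookup -[1+ n ] v ρ = begin
      lookup (map -_ (suc n Fᵈ.×ₙ v)) ρ       ≡⟨ lookup-map ρ -_ (suc n Fᵈ.×ₙ v) ⟩
      - lookup (suc n Fᵈ.×ₙ v) ρ              ≈⟨ -‿cong (×ₙ-lookup (suc n) v ρ) ⟩
      - ((suc n Fᶻ.×ₙ 1#) * lookup v ρ)       ≈⟨ -‿distribˡ-* _ _ ⟩
      toF -[1+ n ] * lookup v ρ               ∎

    ⟨·⟩-lookup : (row : Vec ℤ k) (x : Vec (Vec Carrier d) k) (ρ : Fin d) →
                 lookup (Fᵈ.sumV (zipWith Fᵈ._·_ row x)) ρ ≈ sum (λ t → toF (lookup row t) * lookup (lookup x t) ρ)
    ⟨·⟩-lookup []        []      ρ = reflexive (lookup-replicate ρ 0#)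
    ⟨·⟩-lookup (z ∷ row) (v ∷ x) ρ =
      trans (reflexive (lookup-zipWith _+_ ρ (z Fᵈ.· v) _)) (+-cong (·-lookup z v ρ) (⟨·⟩-lookup row x ρ))

    kernel-coordinate : (A : Vec (Vec ℤ k) l) (x : Vec (Vec Carrier d) k) → Fᵈ.IsZeroVec (A Fᵈ.*ᴹ x) →
                        ∀ ρ → Null (toFMatrix A ⊙ λ t → lookup (lookup x t) ρ)
    kernel-coordinate {l = l} A x Ax≈0 ρ r = begin
      (toFMatrix A ⊙ (λ t → lookup (lookup x t) ρ)) r            ≈⟨ ⟨·⟩-lookup (lookup A r) x ρ ⟨
      lookup (Fᵈ.sumV (zipWith Fᵈ._·_ (lookup A r) x)) ρ           ≡⟨ cong (λ v → lookup v ρ) (lookup-map r _ A) ⟨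
      lookup (lookup (A Fᵈ.*ᴹ x) r) ρ                             ≈⟨ PW.lookup (PW.lookup Ax≈0 r) ρ ⟩
      lookup (lookup (replicate l (replicate d 0#)) r) ρ           ≡⟨ cong (λ v → lookup v ρ) (lookup-replicate r _) ⟩
      lookup (replicate d 0#) ρ                                   ≡⟨ lookup-replicate ρ 0# ⟩
      0#                                                          ∎

  module Rank (A : Vec (Vec ℤ k) l) where
    open Columns (toFMatrix A) public

    dot : ∀ {m} → Vec Carrier m → Vec Carrier m → Carrier
    dot u row = foldr′ _+_ 0# (zipWith _*_ row u)

    spread² : (Q : Subset k) (p : Subset ∣ Q ∣) → Vec Carrier ∣ p ∣ → Vector Carrier k
    spread² Q p u = lookup (scatter 0# Q (scatter 0# p u))

    dot-cols : (Q : Subset k) (p : Subset ∣ Q ∣) (u : Vec Carrier ∣ p ∣) (r : Fin l) →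
               lookup (map (dot u) (cols p (toFMat (cols Q A)))) r ≈ (toFMatrix A ⊙ spread² Q p u) r
    dot-cols Q p u r = begin
      lookup (map (dot u) (cols p (toFMat (cols Q A)))) r           ≡⟨ lookup-map r (dot u) (cols p (toFMat (cols Q A))) ⟩
      dot u (lookup (cols p (toFMat (cols Q A))) r)                 ≡⟨ cong (dot u) row≡ ⟩
      dot u row                                                     ≈⟨ foldr-zipWith-* row u ⟩
      sum (λ i → lookup row i * lookup u i)                         ≡⟨ sum-cong-≗ (λ i → cong (_* lookup u i) (row-entry i)) ⟩
      sum (λ i → toFMatrix A r (enum Q (enum p i)) * lookup u i)    ≈⟨ sum-scatter p (toFMatrix A r ∘ enum Q) u ⟨
      sum (λ j → toFMatrix A r (enum Q j) * lookup (scatter 0# p u) j) ≈⟨ sum-scatter Q (toFMatrix A r) (scatter 0# p u) ⟨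
      (toFMatrix A ⊙ spread² Q p u) r                               ∎
      where
        row : Vec Carrier ∣ p ∣
        row = select p (map toF (select Q (lookup A r)))

        row≡ : lookup (cols p (toFMat (cols Q A))) r ≡ row
        row≡ = ≡.trans (lookup-map r (select p) (toFMat (cols Q A))) (cong (select p)
                 (≡.trans (lookup-map r (map toF) (cols Q A)) (cong (map toF) (lookup-map r (select Q) A))))

        row-entry : ∀ i → lookup row i ≡ toFMatrix A r (enum Q (enum p i))
        row-entry i = ≡.trans (lookup-select p (map toF (select Q (lookup A r))) i)
                        (≡.trans (lookup-map (enum p i) toF (select Q (lookup A r)))
                                 (cong toF (lookup-select Q (lookup A r) (enum p i))))

    linIndepCols⇒independent : (Q : Subset k) (p : Subset ∣ Q ∣) → LinIndepCols (toFMat (cols Q A)) p →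
                               Independent (embed Q p)
    linIndepCols⇒independent Q p indep δ supp Mδ≈0 = δ≈0
      where
        u : Vec Carrier ∣ p ∣
        u = Vec.tabulate (δ ∘ enum Q ∘ enum p)

        δ≈spread : ∀ t → δ t ≈ spread² Q p u t
        δ≈spread t with t ∈? embed Q p
        ... | no  t∉Qp = trans (supp t∉Qp) (sym (reflexive (lookup-scatter²-∉ 0# Q p u t∉Qp)))
        ... | yes t∈Qp with i , ≡.refl ← ∈-embed⁻ Q p t∈Qp = sym (begin
          spread² Q p u (enum Q (enum p i))                 ≡⟨ lookup-scatter-enum 0# Q _ (enum p i) ⟩
          lookup (scatter 0# p u) (enum p i)                ≡⟨ lookup-scatter-enum 0# p u i ⟩
          lookup u i                                        ≡⟨ lookup∘tabulate _ i ⟩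
          δ (enum Q (enum p i))                             ∎)

        u≈0 : Pointwise _≈_ u (replicate ∣ p ∣ 0#)
        u≈0 = indep u (PWₑ.extensional⇒inductive (PWₑ.ext λ r → begin
          lookup (map (dot u) (cols p (toFMat (cols Q A)))) r  ≈⟨ dot-cols Q p u r ⟩
          (toFMatrix A ⊙ spread² Q p u) r                     ≈⟨ ⊙-cong (toFMatrix A) δ≈spread r ⟨
          (toFMatrix A ⊙ δ) r                                 ≈⟨ Mδ≈0 r ⟩
          0#                                                  ≡⟨ lookup-replicate r 0# ⟨
          lookup (replicate l 0#) r                           ∎))

        δ≈0 : Null δ
        δ≈0 t with t ∈? embed Q p
        ... | no  t∉Qp = supp t∉Qp
        ... | yes t∈Qp with i , ≡.refl ← ∈-embed⁻ Q p t∈Qp =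
          trans (reflexive (≡.sym (lookup∘tabulate _ i))) (trans (PW.lookup u≈0 i) (reflexive (lookup-replicate i 0#)))

    independent⇒linIndepCols : {Q S : Subset k} → S ⊆ Q → Independent S →
                               LinIndepCols (toFMat (cols Q A)) (select Q S)
    independent⇒linIndepCols {Q} {S} S⊆Q indS u Au≈0 =
      PWₑ.extensional⇒inductive (PWₑ.ext λ i → begin
        lookup u i                               ≡⟨ lookup-scatter-enum 0# p u i ⟨
        lookup (scatter 0# p u) (enum p i)        ≡⟨ lookup-scatter-enum 0# Q _ (enum p i) ⟨
        spread² Q p u (enum Q (enum p i))        ≈⟨ δ≈0 (enum Q (enum p i)) ⟩
        0#                                       ≡⟨ lookup-replicate i 0# ⟨
        lookup (replicate ∣ p ∣ 0#) i            ∎)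
      where
        p : Subset ∣ Q ∣
        p = select Q S

        δ≈0 : Null (spread² Q p u)
        δ≈0 = indS (spread² Q p u)
          (λ t∉S → reflexive (lookup-scatter²-∉ 0# Q p u (≡.subst (_ ∉_) (≡.sym (embed-select S⊆Q)) t∉S)))
          (λ r → trans (sym (dot-cols Q p u r)) (trans (PW.lookup Au≈0 r) (reflexive (lookup-replicate r 0#))))

    rank⇒maximumIndependent : {Q : Subset k} {r : ℕ} → IsRankF (cols Q A) r →
                              ∃ λ S → MaximumIndependent Q S × ∣ S ∣ ≡ r
    rank⇒maximumIndependent {Q} {r} ((p , ∣p∣≡r , indep) , maximal) =
      embed Q p ,
      record { ⊆Q          = embed⊆Q
             ; independent = linIndepCols⇒independent Q p indep
             ; maximum     = λ {S′} S′⊆Q indS′ → ≡.subst₂ _≤_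
                 (≡.trans (≡.sym (∣embed∣ Q (select Q S′))) (cong ∣_∣ (embed-select S′⊆Q)))
                 (≡.sym (≡.trans (∣embed∣ Q p) ∣p∣≡r))
                 (maximal (select Q S′) (independent⇒linIndepCols S′⊆Q indS′)) } ,
      ≡.trans (∣embed∣ Q p) ∣p∣≡r
      where
        embed⊆Q : embed Q p ⊆ Q
        embed⊆Q t∈Qp with i , ≡.refl ← ∈-embed⁻ Q p t∈Qp = enum-∈ Q (enum p i)

-- Case (ii): S = L^d inside a field

module FieldPower (F : Field c ℓ) (L : List (Field.Carrier F)) (d : ℕ) where
  open Field F hiding (zero)
  open FieldRank F
  open Matrices F
  open IntegerMatrixOverField F
  open Coordinates d
  open ZAction (vecRawGroup d)
  open import Algebra.Properties.AbelianGroup +-abelianGroup using (x∙y⁻¹≈ε⇒x≈y; x≈y⇒x∙y⁻¹≈ε)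
  open SetoidMembership setoid using () renaming (_∈_ to _∈ₛ_)
  private
    Vᵈ : Setoid c (c ⊔ ℓ)
    Vᵈ = PW.setoid setoid d
    module Vᵈ = Setoid Vᵈ

    _≋_ : Vec (Vec Carrier d) m → Vec (Vec Carrier d) m → Set (c ⊔ ℓ)
    _≋_ = Pointwise (Pointwise _≈_)

  solutions≤ : (A : Vec (Vec ℤ k) l) {W Y Q : Subset k} → Rank.Determines A (W ∪ Q) Y →
    (w0 : Vec (Vec Carrier d) ∣ W ∣) {ys : List (Vec (Vec Carrier d) ∣ Y ∣)} →
    SetoidUnique.Unique (PW.setoid (vecSetoid d) ∣ Y ∣) ys → LAll.All (Sol (InL^d L) A W Y w0) ys →
    length ys ≤ (length L ^ d) ^ ∣ Q ∣
  solutions≤ {k = k} A {W} {Y} {Q} determines w0 {ys} ys-unique sols =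
    length≤ (PW.setoid (vecSetoid d) ∣ Y ∣) ys-unique f f-injective
    where
      sol : ∀ i → Sol (InL^d L) A W Y w0 (List.lookup ys i)
      sol i = LAll.lookup sols (∈-lookup i)

      x : Fin (length ys) → Vec (Vec Carrier d) k
      x i = proj₁ (sol i)

      x∈L : ∀ i → VAll.All (InL^d L) (x i)
      x∈L i = proj₁ (proj₂ (sol i))

      A*x≈0 : ∀ i → IsZeroVec (A *ᴹ x i)
      A*x≈0 i = proj₁ (proj₂ (proj₂ (sol i)))

      xY≈y : ∀ i → select Y (x i) ≋ List.lookup ys i
      xY≈y i = proj₁ (proj₂ (proj₂ (proj₂ (sol i))))

      xW≈w0 : ∀ i → select W (x i) ≋ w0
      xW≈w0 i = proj₂ (proj₂ (proj₂ (proj₂ (sol i))))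

      codeQ : Coding (PW.setoid Vᵈ ∣ Q ∣) (VAll.All (InL^d L)) ((length L ^ d) ^ ∣ Q ∣)
      codeQ = vecCoding Vᵈ (vecCoding setoid (listCoding setoid L))

      f : Fin (length ys) → Fin ((length L ^ d) ^ ∣ Q ∣)
      f i = Coding.code codeQ (All-select Q (x∈L i))

      f-injective : ∀ {i j} → f i ≡ f j → List.lookup ys i ≋ List.lookup ys j
      f-injective {i} {j} eq = Vᵈʸ.trans (Vᵈʸ.sym (xY≈y i)) (Vᵈʸ.trans x-on-Y (xY≈y j))
        where
          module Vᵈʸ = Setoid (PW.setoid Vᵈ ∣ Y ∣)
          module Vᵈʷ = Setoid (PW.setoid Vᵈ ∣ W ∣)

          agree-on-W∪Q : ∀ {t} → t ∈ W ∪ Q → lookup (x i) t Vᵈ.≈ lookup (x j) t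
          agree-on-W∪Q t∈W∪Q with x∈p∪q⁻ W Q t∈W∪Q
          ... | inj₁ t∈W = select-pointwise⁻ W (Vᵈʷ.trans (xW≈w0 i) (Vᵈʷ.sym (xW≈w0 j))) t∈W
          ... | inj₂ t∈Q = select-pointwise⁻ Q
                             (Coding.code-injective codeQ (All-select Q (x∈L i)) (All-select Q (x∈L j)) eq) t∈Q

          coordinate-on-Y : ∀ ρ {t} → t ∈ Y → lookup (lookup (x i) t) ρ ≈ lookup (lookup (x j) t) ρ
          coordinate-on-Y ρ {t} t∈Y =
            x∙y⁻¹≈ε⇒x≈y _ _ (determines δ Aδ≈0 (λ t∈W∪Q → x≈y⇒x∙y⁻¹≈ε (PW.lookup (agree-on-W∪Q t∈W∪Q) ρ)) t∈Y)
            where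
              δ : Vector Carrier k
              δ t = lookup (lookup (x i) t) ρ - lookup (lookup (x j) t) ρ

              Aδ≈0 : Null (toFMatrix A ⊙ δ)
              Aδ≈0 r = begin
                (toFMatrix A ⊙ δ) r  ≈⟨ ⊙-− (toFMatrix A) _ _ r ⟩
                _ - _                ≈⟨ +-cong (kernel-coordinate A (x i) (A*x≈0 i) ρ r)
                                               (-‿cong (kernel-coordinate A (x j) (A*x≈0 j) ρ r)) ⟩
                0# - 0#              ≈⟨ -‿inverseʳ 0# ⟩
                0#                   ∎
                where open import Relation.Binary.Reasoning.Setoid setoid

          x-on-Y : select Y (x i) ≋ select Y (x j)
          x-on-Y = select-pointwise⁺ Y λ t∈Y → PWₑ.extensional⇒inductive (PWₑ.ext λ ρ → coordinate-on-Y ρ t∈Y)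

  all-zero : IsZeroSet L → ∀ {m} {v : Vec (Vec Carrier d) m} → VAll.All (InL^d L) v →
             v ≋ replicate m (replicate d 0#)
  all-zero L≈0 []         = []
  all-zero L≈0 (v∈ ∷ vs∈) = entries-zero v∈ ∷ all-zero L≈0 vs∈
    where
      entries-zero : ∀ {m} {u : Vec Carrier m} → VAll.All (_∈ₛ L) u → Pointwise _≈_ u (replicate m 0#)
      entries-zero []       = []
      entries-zero (a∈ ∷ as∈) = proj₁ L≈0 _ a∈ ∷ entries-zero as∈

  solutions≤1 : IsZeroSet L → (A : Vec (Vec ℤ k) l) {W Y : Subset k} (w0 : Vec (Vec Carrier d) ∣ W ∣)
    {ys : List (Vec (Vec Carrier d) ∣ Y ∣)} →
    SetoidUnique.Unique (PW.setoid (vecSetoid d) ∣ Y ∣) ys → LAll.All (Sol (InL^d L) A W Y w0) ys → length ys ≤ 1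
  solutions≤1 L≈0 A {W} {Y} w0 {ys} ys-unique sols =
    length≤ (PW.setoid (vecSetoid d) ∣ Y ∣) ys-unique (λ _ → zero) λ {i} {j} _ →
      Vᵈʸ.trans (y≈0 i) (Vᵈʸ.sym (y≈0 j))
    where
      module Vᵈʸ = Setoid (PW.setoid Vᵈ ∣ Y ∣)
      y≈0 : ∀ i → List.lookup ys i ≋ replicate ∣ Y ∣ (replicate d 0#)
      y≈0 i = Vᵈʸ.trans (Vᵈʸ.sym (proj₁ (proj₂ (proj₂ (proj₂ sol)))))
                        (all-zero L≈0 (All-select Y (proj₁ (proj₂ sol))))
        where
          sol : Sol (InL^d L) A W Y w0 (List.lookup ys i)
          sol = LAll.lookup sols (∈-lookup i)

  length≡1 : ∀ {xs} → SetoidUnique.Unique setoid xs → (∀ x → x ∈ₛ xs → x ≈ 0#) → 0# ∈ₛ xs → length xs ≡ 1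
  length≡1 {[]}         _              _   ()
  length≡1 {a ∷ []}     _              _   _ = ≡.refl
  length≡1 {a ∷ b ∷ xs} ((a∉ ∷ _) ∷ _) xs≈0 _ =
    contradiction (trans (xs≈0 a (here refl)) (sym (xs≈0 b (there (here refl))))) a∉

  solutions-bound : SetoidUnique.Unique setoid L → (A : Vec (Vec ℤ k) l) {W Y : Subset k} → W ⊆ Y →
    (w0 : Vec (Vec Carrier d) ∣ W ∣) {rW rY : ℕ} → IsRankS L (cols (∁ W) A) rW → IsRankS L (cols (∁ Y) A) rY →
    Σ ℕ λ e → (e ℕ.+ ∣ W ∣ ℕ.+ rW ≡ ∣ Y ∣ ℕ.+ rY) ×
      ((ys : List (Vec (Vec Carrier d) ∣ Y ∣)) → SetoidUnique.Unique (PW.setoid (vecSetoid d) ∣ Y ∣) ys →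
       LAll.All (Sol (InL^d L) A W Y w0) ys → length ys ≤ (length L ^ d) ^ e)
  solutions-bound L-unique A {W} {Y} W⊆Y w0 (inj₁ (L≈0 , ≡.refl)) (inj₁ (_ , ≡.refl)) =
    ∣ Y ─ W ∣ ,
    ≡.trans (ℕ.+-identityʳ _)
      (≡.trans (ℕ.+-comm ∣ Y ─ W ∣ ∣ W ∣) (≡.sym (≡.trans (ℕ.+-identityʳ _) (∣Y∣≡∣W∣+∣Y─W∣ W⊆Y)))) ,
    λ ys ys-unique sols → ≡.subst (length ys ≤_) (≡.sym N^e≡1) (solutions≤1 L≈0 A {W} {Y} w0 ys-unique sols)
    where
      N^e≡1 : (length L ^ d) ^ ∣ Y ─ W ∣ ≡ 1
      N^e≡1 rewrite length≡1 L-unique (proj₁ L≈0) (proj₂ L≈0) | ℕ.^-zeroˡ d = ℕ.^-zeroˡ ∣ Y ─ W ∣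
  solutions-bound L-unique A W⊆Y w0 (inj₁ (L≈0 , _)) (inj₂ (L≉0 , _)) = contradiction L≈0 L≉0
  solutions-bound L-unique A W⊆Y w0 (inj₂ (L≉0 , _)) (inj₁ (L≈0 , _)) = contradiction L≈0 L≉0
  solutions-bound L-unique A {W} {Y} W⊆Y w0 (inj₂ (_ , rankW)) (inj₂ (_ , rankY))
    with SW , maxW , ≡.refl ← Rank.rank⇒maximumIndependent A rankW
       | SY , maxY , ≡.refl ← Rank.rank⇒maximumIndependent A rankY =
    e , e-equation , λ ys ys-unique sols → decidable-stable (_ ≤? _) (¬¬-map (bound ys-unique sols) core)
    where
      D : Subset _
      D = Y ─ W

      e : ℕ
      e = ∣ D ∣ ℕ.+ ∣ SY ∣ ∸ ∣ SW ∣

      core : ¬ ¬ (∣ SW ∣ ≤ ∣ D ∣ ℕ.+ ∣ SY ∣ × ∃ λ Q → Q ⊆ D × ∣ Q ∣ ≡ e × Rank.Determines A (W ∪ Q) Y)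
      core = Rank.determining-subset A W⊆Y maxW maxY

      e-equation : e ℕ.+ ∣ W ∣ ℕ.+ ∣ SW ∣ ≡ ∣ Y ∣ ℕ.+ ∣ SY ∣
      e-equation = ∸+-rearrange (∣Y∣≡∣W∣+∣Y─W∣ W⊆Y) (decidable-stable (_ ≤? _) (¬¬-map proj₁ core))

      bound : ∀ {ys} → SetoidUnique.Unique (PW.setoid (vecSetoid d) ∣ Y ∣) ys → LAll.All (Sol (InL^d L) A W Y w0) ys →
              (∣ SW ∣ ≤ ∣ D ∣ ℕ.+ ∣ SY ∣ × ∃ λ Q → Q ⊆ D × ∣ Q ∣ ≡ e × Rank.Determines A (W ∪ Q) Y) →
              length ys ≤ (length L ^ d) ^ e
      bound {ys} ys-unique sols (_ , Q , _ , ∣Q∣≡e , determines) =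
        ≡.subst (λ m → length ys ≤ (length L ^ d) ^ m) ∣Q∣≡e (solutions≤ A determines w0 ys-unique sols)
open import Data.Nat using (_+_; _*_)

lemma6p16 : ∀ {c ℓ : Level} →
    -- case (i): S is a finite abelian group G with |S| = n
    ((G : AbelianGroup c ℓ) (n : ℕ) →
      let open AbelianGroup G
          open ZAction rawGroup
      in Card.HasCard setoid (λ _ → ⊤ {ℓ = c}) n →
      (l k : ℕ) (A : Vec (Vec ℤ k) l) (W Y : Subset k) → W ⊆ Y →
      (w0 : Vec Carrier ∣ W ∣) (mW mY : ℕ) →
      Card.HasCard (PW.setoid setoid l) (Img (cols (∁ W) A)) mW →
      Card.HasCard (PW.setoid setoid l) (Img (cols (∁ Y) A)) mY →
      (ys : List (Vec Carrier ∣ Y ∣)) →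
      Card.Unique (PW.setoid setoid ∣ Y ∣) ys →
      LAll.All (Sol (λ _ → ⊤ {ℓ = c}) A W Y w0) ys →
      length ys * mW ≤ n ^ (∣ Y ∣ ∸ ∣ W ∣) * mY)
    ×
    -- case (ii): S = L^d for a finite subset L of a field F
    ((F : Field c ℓ) (L : List (Field.Carrier F)) →
      Card.Unique (Field.setoid F) L → (d : ℕ) →
      let open FieldRank F
          open ZAction (vecRawGroup d)
      in
      (l k : ℕ) (A : Vec (Vec ℤ k) l) (W Y : Subset k) → W ⊆ Y →
      (w0 : Vec (Vec (Field.Carrier F) d) ∣ W ∣) → VAll.All (InL^d L) w0 →
      (rW rY : ℕ) → IsRankS L (cols (∁ W) A) rW → IsRankS L (cols (∁ Y) A) rY →
      Σ ℕ λ e → (e + ∣ W ∣ + rW ≡ ∣ Y ∣ + rY) ×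
        ((ys : List (Vec (Vec (Field.Carrier F) d) ∣ Y ∣)) →
          Card.Unique (PW.setoid (vecSetoid d) ∣ Y ∣) ys →
          LAll.All (Sol (InL^d L) A W Y w0) ys →
          length ys ≤ (length L ^ d) ^ e))
lemma6p16 = (λ G n → FiniteAbelianGroup.solutions-bound G) ,
            λ F L L-unique d l k A W Y W⊆Y w0 _ rW rY rankW rankY →
              FieldPower.solutions-bound F L d L-unique A W⊆Y w0 rankW rankY
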